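{- (i) For each even integer $L\ge 2$ there is a 4-representative $x$ with eventually periodic sequence of partial quotients and an integer $N\ge0$ such that the Jacobi sequence $\left(\frac{s_k}{t_k}\right)$ of $x$ satisfies, for all $k\ge N$, $\left(\frac{s_k}{t_k}\right)=-1$ if $k\equiv N+L-1\pmod L$ and $\left(\frac{s_k}{t_k}\right)=1$ otherwise; i.e. the Jacobi sequence has the period $1,1,\ldots,1,-1$ in which $1$ is repeated $L-1$ times. (ii) There are uncountably many distinct sequences that are not eventually periodic and that occur as Jacobi sequences of 4-representatives $x\in\mathbb{R}\setminus\mathbb{Q}$.
   Context: For $x\in\mathbb{R}\setminus\mathbb{Q}$ with regular continued fraction expansion $x=[a_0,a_1,a_2,\ldots]$, the convergents $s_k/t_k$ are defined by $s_{ -1}=1$, $s_0=a_0$, $s_k=a_ks_{k-1}+s_{k-2}$ and $t_{ -1}=0$, $t_0=1$, $t_k=a_kt_{k-1}+t_{k-2}$ for $k\ge1$. For odd natural $n$ and integer $m$ coprime to $n$, $\left(\frac{m}{n}\right)$ is the Jacobi symbol; for even $n$ one sets $\left(\frac{m}{n}\right)=*$, a fixed symbol different from $\pm1$. The Jacobi sequence of $x$ is $\left(\frac{s_k}{t_k}\right)$, $k\ge0$. A 4-representative is an irrational number $x=[b_0,b_1,b_2,\ldots]$ with $b_k\in\{1,2,3,4\}$ for all $k\ge0$. -}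

module Defs where

open import Data.Nat using (ℕ; zero; suc; _+_; _*_; _≤_; _<_; NonZero)
open import Data.Nat.DivMod using (_%_)
open import Data.Nat.Divisibility using (_∣?_)
open import Data.Nat.Primality.Factorisation using (factorise; factors)
open import Data.Integer using (ℤ; +_; -[1+_]; _-_)
import Data.Integer.Divisibility as ℤDiv
open import Data.List using (List; map; upTo)
open import Data.Bool.ListAction using (any)
open import Data.Bool using (Bool; true; false; if_then_else_)
open import Data.Product using (Σ; ∃; _×_)
open import Relation.Nullary using (yes; no; does)
open import Relation.Binary.PropositionalEquality using (_≡_)
import Data.Nat as ℕ

prodℤ : List ℤ → ℤ
prodℤ Data.List.[] = + 1
prodℤ (z Data.List.∷ zs) = z Data.Integer.* prodℤ zs

legendre : ℕ → ℕ → ℤ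
legendre a zero = + 0
legendre a p@(suc q) with p ∣? a
... | yes _ = + 0
... | no _ =
  if any (λ x → does ((x * x) % p ℕ.≟ a % p)) (upTo p)
  then + 1 else -[1+ 0 ]

-- Values of the Jacobi sequence: an integer, or the symbol * (even modulus).
data JVal : Set where
  val  : ℤ → JVal
  star : JVal

jacobi : ℕ → ℕ → JVal
jacobi m zero = star
jacobi m n@(suc k) with 2 ∣? n
... | yes _ = star
... | no _  = val (prodℤ (map (legendre m) (factors (factorise n))))

-- Convergents s_k / t_k of [b 0, b 1, b 2, ...].
s : (ℕ → ℕ) → ℕ → ℕ
s b zero = b 0
s b (suc zero) = b 1 * b 0 + 1
s b (suc (suc k)) = b (suc (suc k)) * s b (suc k) + s b k

t : (ℕ → ℕ) → ℕ → ℕ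
t b zero = 1
t b (suc zero) = b 1
t b (suc (suc k)) = b (suc (suc k)) * t b (suc k) + t b k

jacobiSeq : (ℕ → ℕ) → ℕ → JVal
jacobiSeq b k = jacobi (s b k) (t b k)

-- b is the partial-quotient sequence of a 4-representative.
IsFourRep : (ℕ → ℕ) → Set
IsFourRep b = ∀ k → (1 ≤ b k) × (b k ≤ 4)

EventuallyPeriodic : {A : Set} → (ℕ → A) → Set
EventuallyPeriodic f = ∃ λ N → ∃ λ p → (0 < p) × (∀ k → N ≤ k → f (p + k) ≡ f k)

_≡_[mod_] : ℕ → ℕ → ℕ → Set
a ≡ b [mod L ] = (+ L) ℤDiv.∣ ((+ a) - (+ b))

{-# OPTIONS --safe #-}
-- (i) The partial quotients are chosen so that every denominator tₖ is odd and no two consecutive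
-- ones are ≡ 3 (mod 4). The determinant identity s₍ₖ₊₁₎ tₖ − sₖ t₍ₖ₊₁₎ = (−1)ᵏ makes consecutive
-- denominators coprime and gives sₖ t₍ₖ₋₁₎ ≡ ±1 (mod tₖ). Jacobi reciprocity, derived from quadratic
-- reciprocity (Gauss's lemma and Eisenstein's lattice count), then yields (t₍ₖ₋₁₎ / tₖ) = 1 by induction,
-- so (sₖ / tₖ) is 1 for odd k and (−1 / tₖ) = (−1)^((tₖ − 1)/2) for even k. Taking partial quotients 2 or 4
-- steers tₖ mod 4 so that tₖ ≡ 3 (mod 4) exactly at k = 2 + mL.
-- (ii) With partial quotients 1 or 2 the parity of tₖ, hence the places where the Jacobi sequence is *,
-- can be prescribed at all odd k. Recording the squares at k = 4n + 1 rules out eventual periodicity, and a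
-- diagonal choice at k = 4n + 3 avoids every sequence of a given countable family.
module Submission where

open import Defs
open import Data.Bool using (Bool; true; false; T; not; if_then_else_; _xor_)
open import Data.Bool.ListAction using (any)
open import Data.Bool.Properties using (not-involutive; not-¬)
open import Data.Empty using (⊥; ⊥-elim)
import Data.Integer as ℤ
import Data.Integer.Properties as ℤₚ
import Data.Integer.Tactic.RingSolver as ℤ-Solver
open ℤ using (ℤ; 0ℤ; 1ℤ; -1ℤ)
open import Data.List using (List; []; _∷_; length; map; applyDownFrom; upTo)
open import Data.List.Properties using (length-applyDownFrom; map-applyDownFrom; map-cong-local)
open import Data.List.Membership.Propositional using (_∈_; lose)
open import Data.List.Membership.Propositional.Properties using (∈-applyDownFrom⁺; ∈-applyDownFrom⁻; ∈-upTo⁺)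
open import Data.List.Relation.Unary.All as All using (All; []; _∷_)
import Data.List.Relation.Unary.All.Properties as All
open import Data.List.Relation.Unary.Any using (here; there; satisfied; any?)
open import Data.List.Relation.Unary.Any.Properties using (any⁺; any⁻)
open import Data.List.Relation.Unary.AllPairs using ([]; _∷_)
open import Data.List.Relation.Unary.Unique.Propositional using (Unique)
import Data.List.Relation.Unary.Unique.Propositional.Properties as Unique
open import Data.List.Relation.Binary.Permutation.Propositional using (_↭_; prep; swap; ↭-refl; ↭-trans)
open import Data.Nat
open import Data.Nat.Properties
open import Data.Nat.DivMod
open import Data.Nat.Divisibility
open import Data.Nat.Primality
open import Data.Nat.Primality.Factorisation
open import Data.Nat.Coprimality using (Coprime)
open import Data.Nat.ListAction using (sum; product)
open import Data.Nat.ListAction.Properties using (sum-↭; product-↭; ∈⇒∣product)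
open import Data.Nat.Tactic.RingSolver using (solve-∀)
open import Data.List.Membership.DecPropositional _≟_ using (_∈?_)
open import Data.Product using (Σ; ∃; _×_; _,_; proj₁; proj₂)
open import Data.Sum using (_⊎_; inj₁; inj₂)
open import Function using (_∘_; _⇔_; mk⇔; Equivalence)
open import Relation.Nullary using (¬_; yes; no; does)
open import Relation.Nullary.Decidable using (dec-true; dec-false)
open import Relation.Binary.PropositionalEquality

-- Distinct lists of positive integers

downFrom⁺ : ℕ → List ℕ
downFrom⁺ = applyDownFrom suc

InRange : ℕ → ℕ → Set
InRange n x = 1 ≤ x × x ≤ n

∈-downFrom⁺⁻ : ∀ {n x} → x ∈ downFrom⁺ n → InRange n x
∈-downFrom⁺⁻ x∈ with i , i<n , refl ← ∈-applyDownFrom⁻ suc x∈ = s≤s z≤n , i<n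

∈-downFrom⁺⁺ : ∀ {n x} → InRange n x → x ∈ downFrom⁺ n
∈-downFrom⁺⁺ {x = suc x} (_ , x<n) = ∈-applyDownFrom⁺ suc x<n

product-downFrom⁺ : ∀ n → product (downFrom⁺ n) ≡ n !
product-downFrom⁺ zero = refl
product-downFrom⁺ (suc n) = cong (suc n *_) (product-downFrom⁺ n)

Unique-downFrom⁺ : ∀ n → Unique (downFrom⁺ n)
Unique-downFrom⁺ n = Unique.applyDownFrom⁺₁ suc n (λ j<i _ → <⇒≢ (s≤s j<i) ∘ sym)

remove : ℕ → List ℕ → List ℕ
remove k [] = []
remove k (x ∷ xs) with x ≟ k
... | yes _ = xs
... | no _ = x ∷ remove k xs

module _ (k : ℕ) where

  ↭-remove : ∀ {xs} → k ∈ xs → xs ↭ k ∷ remove k xs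
  ↭-remove {x ∷ xs} k∈ with x ≟ k
  ... | yes refl = ↭-refl
  ↭-remove {x ∷ xs} (here k≡x) | no x≢k = ⊥-elim (x≢k (sym k≡x))
  ↭-remove {x ∷ xs} (there k∈) | no _ = ↭-trans (prep x (↭-remove k∈)) (swap x k ↭-refl)

  length-remove : ∀ {xs} → k ∈ xs → length xs ≡ suc (length (remove k xs))
  length-remove {x ∷ xs} k∈ with x ≟ k
  ... | yes refl = refl
  length-remove {x ∷ xs} (here k≡x) | no x≢k = ⊥-elim (x≢k (sym k≡x))
  length-remove {x ∷ xs} (there k∈) | no _ = cong suc (length-remove k∈)

  All-remove : ∀ {P : ℕ → Set} {xs} → All P xs → All P (remove k xs)
  All-remove {xs = []} [] = []
  All-remove {xs = x ∷ xs} (px ∷ pxs) with x ≟ k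
  ... | yes _ = pxs
  ... | no _ = px ∷ All-remove pxs

  Unique-remove : ∀ {xs} → Unique xs → Unique (remove k xs)
  Unique-remove {[]} [] = []
  Unique-remove {x ∷ xs} (x∉ ∷ u) with x ≟ k
  ... | yes _ = u
  ... | no _ = All-remove x∉ ∷ Unique-remove u

  ∉-remove : ∀ {xs} → Unique xs → All (k ≢_) (remove k xs)
  ∉-remove {[]} [] = []
  ∉-remove {x ∷ xs} (x∉ ∷ u) with x ≟ k
  ... | yes refl = x∉
  ... | no x≢k = (x≢k ∘ sym) ∷ ∉-remove u

  ∈-remove⁻ : ∀ {z xs} → z ∈ remove k xs → z ∈ xs
  ∈-remove⁻ {xs = x ∷ xs} z∈ with x ≟ k
  ... | yes _ = there z∈
  ∈-remove⁻ {xs = x ∷ xs} (here z≡x) | no _ = here z≡x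
  ∈-remove⁻ {xs = x ∷ xs} (there z∈) | no _ = there (∈-remove⁻ z∈)

  ∈-remove⁺ : ∀ {z xs} → z ∈ xs → z ≢ k → z ∈ remove k xs
  ∈-remove⁺ {xs = x ∷ xs} z∈ z≢k with x ≟ k
  ∈-remove⁺ {xs = x ∷ xs} (here refl) z≢k | yes x≡k = ⊥-elim (z≢k x≡k)
  ∈-remove⁺ {xs = x ∷ xs} (there z∈) z≢k | yes _ = z∈
  ∈-remove⁺ {xs = x ∷ xs} (here z≡x) z≢k | no _ = here z≡x
  ∈-remove⁺ {xs = x ∷ xs} (there z∈) z≢k | no _ = there (∈-remove⁺ z∈ z≢k)

private
  narrow : ∀ {n xs} → All (InRange (suc n)) xs → All (suc n ≢_) xs → All (InRange n) xs
  narrow inR ≢n = All.zipWith (λ ((1≤x , x≤) , n≢x) → 1≤x , ≤-pred (≤∧≢⇒< x≤ (n≢x ∘ sym))) (inR , ≢n)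

length-≤-InRange : ∀ n {xs} → Unique xs → All (InRange n) xs → length xs ≤ n
length-≤-InRange zero {[]} _ _ = z≤n
length-≤-InRange zero {x ∷ xs} _ ((1≤x , x≤0) ∷ _) = ⊥-elim (<⇒≱ 1≤x x≤0)
length-≤-InRange (suc n) {xs} u inR with suc n ∈? xs
... | yes n∈ = subst (_≤ suc n) (sym (length-remove (suc n) n∈))
      (s≤s (length-≤-InRange n (Unique-remove (suc n) u)
        (narrow (All-remove (suc n) inR) (∉-remove (suc n) u))))
... | no n∉ = m≤n⇒m≤1+n (length-≤-InRange n u (narrow inR (All.¬Any⇒All¬ xs n∉)))

↭-downFrom⁺ : ∀ n {xs} → Unique xs → All (InRange n) xs → length xs ≡ n → xs ↭ downFrom⁺ n
↭-downFrom⁺ zero {[]} _ _ _ = ↭-refl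
↭-downFrom⁺ (suc n) {xs} u inR len with suc n ∈? xs
... | yes n∈ = ↭-trans (↭-remove (suc n) n∈) (prep (suc n)
      (↭-downFrom⁺ n (Unique-remove (suc n) u) (narrow (All-remove (suc n) inR) (∉-remove (suc n) u))
        (suc-injective (trans (sym (length-remove (suc n) n∈)) len))))
... | no n∉ = ⊥-elim (<-irrefl len (s≤s (length-≤-InRange n u (narrow inR (All.¬Any⇒All¬ xs n∉)))))

↭-downFrom⁺-image : ∀ n (g : ℕ → ℕ) → (∀ {i} → InRange n i → InRange n (g i)) →
  (∀ {i j} → InRange n i → InRange n j → g i ≡ g j → i ≡ j) →
  map g (downFrom⁺ n) ↭ downFrom⁺ n
↭-downFrom⁺-image n g maps injective = subst (_↭ downFrom⁺ n) (sym (map-applyDownFrom suc g n)) (↭-downFrom⁺ n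
  (Unique.applyDownFrom⁺₁ (g ∘ suc) n λ j<i i<n g≡ →
    <⇒≢ j<i (sym (suc-injective (injective (s≤s z≤n , i<n) (s≤s z≤n , <-trans j<i i<n) g≡))))
  (All.applyDownFrom⁺₁ (g ∘ suc) n λ i<n → maps (s≤s z≤n , i<n))
  (length-applyDownFrom (g ∘ suc) n))

-- Congruences

^-distrib-* : ∀ m n k → (m * n) ^ k ≡ m ^ k * n ^ k
^-distrib-* m n zero = refl
^-distrib-* m n (suc k) = trans (cong (m * n *_) (^-distrib-* m n k)) (interchange m n (m ^ k) (n ^ k))
  where
  interchange : ∀ a b c d → a * b * (c * d) ≡ a * c * (b * d)
  interchange = solve-∀

module Modular (p : ℕ) .{{_ : NonZero p}} where

  infix 4 _≈_
  _≈_ : ℕ → ℕ → Set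
  x ≈ y = x % p ≡ y % p

  +-cong : ∀ {a a′ b b′} → a ≈ a′ → b ≈ b′ → a + b ≈ a′ + b′
  +-cong {a} {a′} {b} {b′} a≈ b≈ = begin
    (a + b) % p                 ≡⟨ %-distribˡ-+ a b p ⟩
    (a % p + b % p) % p         ≡⟨ cong₂ (λ u v → (u + v) % p) a≈ b≈ ⟩
    (a′ % p + b′ % p) % p       ≡⟨ %-distribˡ-+ a′ b′ p ⟨
    (a′ + b′) % p               ∎
    where open ≡-Reasoning

  *-cong : ∀ {a a′ b b′} → a ≈ a′ → b ≈ b′ → a * b ≈ a′ * b′
  *-cong {a} {a′} {b} {b′} a≈ b≈ = begin
    (a * b) % p                 ≡⟨ %-distribˡ-* a b p ⟩
    (a % p * (b % p)) % p       ≡⟨ cong₂ (λ u v → (u * v) % p) a≈ b≈ ⟩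
    (a′ % p * (b′ % p)) % p     ≡⟨ %-distribˡ-* a′ b′ p ⟨
    (a′ * b′) % p               ∎
    where open ≡-Reasoning

  *-congˡ : ∀ a {b b′} → b ≈ b′ → a * b ≈ a * b′
  *-congˡ a = *-cong {a} refl

  ^-cong : ∀ {a a′} n → a ≈ a′ → a ^ n ≈ a′ ^ n
  ^-cong zero a≈ = refl
  ^-cong (suc n) a≈ = *-cong a≈ (^-cong n a≈)

  %-≈ : ∀ a → a % p ≈ a
  %-≈ a = m%n%n≡m%n a p

  ≈-+-multiple : ∀ a k → a + k * p ≈ a
  ≈-+-multiple a k = [m+kn]%n≡m%n a k p

  ≈⇒∣∸ : ∀ {x y} → x ≤ y → x ≈ y → p ∣ y ∸ x
  ≈⇒∣∸ {x} {y} x≤y x≈y = divides (y / p ∸ x / p) (begin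
    y ∸ x                                         ≡⟨ cong₂ _∸_ (m≡m%n+[m/n]*n y p) (m≡m%n+[m/n]*n x p) ⟩
    (y % p + y / p * p) ∸ (x % p + x / p * p)     ≡⟨ cong (λ u → (y % p + y / p * p) ∸ (u + x / p * p)) x≈y ⟩
    (y % p + y / p * p) ∸ (y % p + x / p * p)     ≡⟨ [m+n]∸[m+o]≡n∸o (y % p) _ _ ⟩
    y / p * p ∸ x / p * p                         ≡⟨ *-distribʳ-∸ p (y / p) (x / p) ⟨
    (y / p ∸ x / p) * p                           ∎)
    where open ≡-Reasoning

  ∣∸⇒≈ : ∀ {x y} → x ≤ y → p ∣ y ∸ x → x ≈ y
  ∣∸⇒≈ {x} {y} x≤y (divides k y∸x≡kp) = sym (begin
    y % p                 ≡⟨ cong (_% p) (m+[n∸m]≡n x≤y) ⟨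
    (x + (y ∸ x)) % p     ≡⟨ cong (λ u → (x + u) % p) y∸x≡kp ⟩
    (x + k * p) % p       ≡⟨ ≈-+-multiple x k ⟩
    x % p                 ∎)
    where open ≡-Reasoning

  0%p≡0 : 0 % p ≡ 0
  0%p≡0 = m<n⇒m%n≡m (>-nonZero⁻¹ p)

  ≈0⇒∣ : ∀ {x} → x ≈ 0 → p ∣ x
  ≈0⇒∣ {x} x≈0 = m%n≡0⇒n∣m x p (trans x≈0 0%p≡0)

  ∣⇒≈0 : ∀ {x} → p ∣ x → x ≈ 0
  ∣⇒≈0 {x} p∣x = trans (n∣m⇒m%n≡0 x p p∣x) (sym 0%p≡0)

  ≈∧<⇒≡ : ∀ {x y} → x < p → y < p → x ≈ y → x ≡ y
  ≈∧<⇒≡ x<p y<p x≈y = trans (sym (m<n⇒m%n≡m x<p)) (trans x≈y (m<n⇒m%n≡m y<p))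

  ∣suc⇒≈p∸1 : ∀ {c} → p ∣ suc c → c ≈ p ∸ 1
  ∣suc⇒≈p∸1 (divides zero c+1≡0) = ⊥-elim (1+n≢0 c+1≡0)
  ∣suc⇒≈p∸1 {c} (divides (suc m) c+1≡[m+1]p) = trans (cong (_% p) c≡) (≈-+-multiple (p ∸ 1) m)
    where
    c≡ : c ≡ p ∸ 1 + m * p
    c≡ = suc-injective (trans c+1≡[m+1]p (cong (_+ m * p) (sym (suc-pred p))))

  private
    pair-up : ∀ n (f : ℕ → ℕ) c {xs} → length xs ≤ n → Unique xs →
      (∀ {x} → x ∈ xs → f x ∈ xs) → (∀ {x} → x ∈ xs → f (f x) ≡ x) → (∀ {x} → x ∈ xs → f x ≢ x) →
      (∀ {x} → x ∈ xs → x * f x ≈ c) → ∃ λ m → m + m ≡ length xs × product xs ≈ c ^ m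
    pair-up _ f c {[]} _ _ _ _ _ _ = 0 , refl , refl
    pair-up (suc n) f c {x ∷ xs} (s≤s len) (x∉ ∷ u) closed invol nofix pairs =
      suc m , length-eq , product-eq
      where
      fx∈xs : f x ∈ xs
      fx∈xs with closed (here refl)
      ... | here fx≡x = ⊥-elim (nofix (here refl) fx≡x)
      ... | there fx∈ = fx∈

      ys = remove (f x) xs

      ys⊆ : ∀ {z} → z ∈ ys → z ∈ x ∷ xs
      ys⊆ = there ∘ ∈-remove⁻ (f x)

      x≢ : ∀ {z} → z ∈ ys → x ≢ z
      x≢ z∈ = All.lookup x∉ (∈-remove⁻ (f x) z∈)

      fx≢ : ∀ {z} → z ∈ ys → f x ≢ z
      fx≢ = All.lookup (∉-remove (f x) u)

      closed′ : ∀ {z} → z ∈ ys → f z ∈ ys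
      closed′ {z} z∈ with closed (ys⊆ z∈)
      ... | here fz≡x = ⊥-elim (fx≢ z∈ (trans (cong f (sym fz≡x)) (invol (ys⊆ z∈))))
      ... | there fz∈ = ∈-remove⁺ (f x) fz∈ λ fz≡fx →
              x≢ z∈ (trans (sym (invol (here refl))) (trans (cong f (sym fz≡fx)) (invol (ys⊆ z∈))))

      rest = pair-up n f c {ys} (≤-trans (n≤1+n _) (subst (_≤ n) (length-remove (f x) fx∈xs) len))
               (Unique-remove (f x) u) closed′ (invol ∘ ys⊆) (nofix ∘ ys⊆) (pairs ∘ ys⊆)
      m = proj₁ rest

      length-eq : suc m + suc m ≡ suc (length xs)
      length-eq = cong suc (trans (+-suc m m)
                    (trans (cong suc (proj₁ (proj₂ rest))) (sym (length-remove (f x) fx∈xs))))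

      product-eq : x * product xs ≈ c * c ^ m
      product-eq = begin
        (x * product xs) % p           ≡⟨ cong (λ u → (x * u) % p) (product-↭ (↭-remove (f x) fx∈xs)) ⟩
        (x * (f x * product ys)) % p   ≡⟨ cong (_% p) (*-assoc x (f x) _) ⟨
        (x * f x * product ys) % p     ≡⟨ *-cong (pairs (here refl)) (proj₂ (proj₂ rest)) ⟩
        (c * c ^ m) % p                ∎
        where open ≡-Reasoning

  product-involution : ∀ (f : ℕ → ℕ) c {xs} → Unique xs →
    (∀ {x} → x ∈ xs → f x ∈ xs) → (∀ {x} → x ∈ xs → f (f x) ≡ x) → (∀ {x} → x ∈ xs → f x ≢ x) →
    (∀ {x} → x ∈ xs → x * f x ≈ c) → ∃ λ m → m + m ≡ length xs × product xs ≈ c ^ m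
  product-involution f c {xs} = pair-up (length xs) f c ≤-refl

  product-multiples : ∀ a n → product (map (λ j → (a * j) % p) (downFrom⁺ n)) ≈ a ^ n * n !
  product-multiples a zero = refl
  product-multiples a (suc n) = begin
    ((a * suc n) % p * product (map (λ j → (a * j) % p) (downFrom⁺ n))) % p
      ≡⟨ *-cong (%-≈ (a * suc n)) (product-multiples a n) ⟩
    (a * suc n * (a ^ n * n !)) % p
      ≡⟨ cong (_% p) (rearrange a (suc n) (a ^ n) (n !)) ⟩
    (a * a ^ n * (suc n * n !)) % p ∎
    where
    open ≡-Reasoning
    rearrange : ∀ a m b c → a * m * (b * c) ≡ a * b * (m * c)
    rearrange = solve-∀

  IsSquare : ℕ → Set
  IsSquare a = ∃ λ x → x * x ≈ a

legendre-∣ : ∀ p .{{_ : NonZero p}} {a} → p ∣ a → legendre a p ≡ 0ℤ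
legendre-∣ (suc k) {a} p∣a with suc k ∣? a
... | yes _ = refl
... | no p∤a = ⊥-elim (p∤a p∣a)

legendre-∤ : ∀ p .{{_ : NonZero p}} {a} → p ∤ a →
  (legendre a p ≡ 1ℤ × Modular.IsSquare p a) ⊎ (legendre a p ≡ -1ℤ × ¬ Modular.IsSquare p a)
legendre-∤ p@(suc k) {a} p∤a with p ∣? a
... | yes p∣a = ⊥-elim (p∤a p∣a)
... | no _ with any (λ x → does ((x * x) % p ≟ a % p)) (upTo p) in found
...   | true with x , x²≈a ← satisfied (any⁻ _ (upTo p) (subst T (sym found) _)) = inj₁ (refl , x , ≡ᵇ⇒≡ _ _ x²≈a)
...   | false = inj₂ (refl , λ (x , x²≈a) → subst T found (any⁺ _ (lose (∈-upTo⁺ (m%n<n x p))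
                  (≡⇒≡ᵇ _ _ (trans (sym (%-distribˡ-* x x p)) x²≈a)))))

module _ (p : ℕ) .{{_ : NonZero p}} where

  open Modular p

  legendre-cong : ∀ {a b} → a ≈ b → legendre a p ≡ legendre b p
  legendre-cong {a} {b} a≈b with p ∣? a
  ... | yes p∣a = trans (legendre-∣ p p∣a) (sym (legendre-∣ p (≈0⇒∣ (trans (sym a≈b) (∣⇒≈0 p∣a)))))
  ... | no p∤a with legendre-∤ p p∤a | legendre-∤ p {b} (λ p∣b → p∤a (≈0⇒∣ (trans a≈b (∣⇒≈0 p∣b))))
  ...   | inj₁ (a↦1 , _) | inj₁ (b↦1 , _) = trans a↦1 (sym b↦1)
  ...   | inj₂ (a↦-1 , _) | inj₂ (b↦-1 , _) = trans a↦-1 (sym b↦-1)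
  ...   | inj₁ (_ , x , x²≈a) | inj₂ (_ , ¬□b) = ⊥-elim (¬□b (x , trans x²≈a a≈b))
  ...   | inj₂ (_ , ¬□a) | inj₁ (_ , x , x²≈b) = ⊥-elim (¬□a (x , trans x²≈b (sym a≈b)))

-- Fermat and Wilson

prime⇒1< : ∀ {p} → Prime p → 1 < p
prime⇒1< {suc (suc _)} _ = s≤s (s≤s z≤n)

module PrimeModulus {p : ℕ} (prime : Prime p) where

  instance
    p≢0 : NonZero p
    p≢0 = prime⇒nonZero prime

  open Modular p public

  1<p : 1 < p
  1<p = prime⇒1< prime

  suc[p∸1]≡p : suc (p ∸ 1) ≡ p
  suc[p∸1]≡p = suc-pred p

  <p⇒≤p∸1 : ∀ {x} → x < p → x ≤ p ∸ 1
  <p⇒≤p∸1 = <⇒≤pred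

  ∤-* : ∀ {a b} → p ∤ a → p ∤ b → p ∤ a * b
  ∤-* {a} {b} p∤a p∤b p∣ab with euclidsLemma a b prime p∣ab
  ... | inj₁ p∣a = p∤a p∣a
  ... | inj₂ p∣b = p∤b p∣b

  ∤-< : ∀ {j} → 1 ≤ j → j < p → p ∤ j
  ∤-< {suc j} _ j<p p∣j = <⇒≱ j<p (∣⇒≤ p∣j)

  ∤-! : ∀ {n} → n < p → p ∤ n !
  ∤-! {zero} _ p∣1 = <⇒≱ 1<p (∣⇒≤ p∣1)
  ∤-! {suc n} n<p = ∤-* (∤-< (s≤s z≤n) n<p) (∤-! (<-trans (n<1+n n) n<p))

  ∤⇒≥1 : ∀ {x} → p ∤ x → 1 ≤ x
  ∤⇒≥1 {zero} p∤0 = ⊥-elim (p∤0 (p ∣0))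
  ∤⇒≥1 {suc x} _ = s≤s z≤n

  ∤-% : ∀ {x} → p ∤ x → p ∤ x % p
  ∤-% {x} p∤x p∣x%p = p∤x (≈0⇒∣ (trans (sym (%-≈ x)) (∣⇒≈0 p∣x%p)))

  private
    *-cancelˡ-≈-≤ : ∀ {a i j} → p ∤ a → i ≤ j → a * i ≈ a * j → i ≈ j
    *-cancelˡ-≈-≤ {a} {i} {j} p∤a i≤j ai≈aj with euclidsLemma a (j ∸ i) prime
      (subst (p ∣_) (sym (*-distribˡ-∸ a j i)) (≈⇒∣∸ (*-monoʳ-≤ a i≤j) ai≈aj))
    ... | inj₁ p∣a = ⊥-elim (p∤a p∣a)
    ... | inj₂ p∣j∸i = ∣∸⇒≈ i≤j p∣j∸i

  *-cancelˡ-≈ : ∀ {a i j} → p ∤ a → a * i ≈ a * j → i ≈ j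
  *-cancelˡ-≈ {i = i} {j} p∤a ai≈aj with ≤-total i j
  ... | inj₁ i≤j = *-cancelˡ-≈-≤ p∤a i≤j ai≈aj
  ... | inj₂ j≤i = sym (*-cancelˡ-≈-≤ p∤a j≤i (sym ai≈aj))

  ↭-multiples : ∀ {a} → p ∤ a → map (λ j → (a * j) % p) (downFrom⁺ (p ∸ 1)) ↭ downFrom⁺ (p ∸ 1)
  ↭-multiples {a} p∤a = ↭-downFrom⁺-image (p ∸ 1) (λ i → (a * i) % p) maps injective
    where
    <p : ∀ {i} → i ≤ p ∸ 1 → i < p
    <p i≤ = ≤-trans (s≤s i≤) (≤-reflexive suc[p∸1]≡p)
    maps : ∀ {i} → InRange (p ∸ 1) i → InRange (p ∸ 1) ((a * i) % p)
    maps (1≤i , i≤) = ∤⇒≥1 (∤-% (∤-* p∤a (∤-< 1≤i (<p i≤)))) , <p⇒≤p∸1 (m%n<n _ p)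
    injective : ∀ {i j} → InRange (p ∸ 1) i → InRange (p ∸ 1) j → (a * i) % p ≡ (a * j) % p → i ≡ j
    injective (_ , i≤) (_ , j≤) ai≈aj = ≈∧<⇒≡ (<p i≤) (<p j≤) (*-cancelˡ-≈ p∤a ai≈aj)

  fermat : ∀ {a} → p ∤ a → a ^ (p ∸ 1) ≈ 1
  fermat {a} p∤a = *-cancelˡ-≈ (∤-! (≤-reflexive suc[p∸1]≡p)) (begin
    ((p ∸ 1) ! * a ^ (p ∸ 1)) % p  ≡⟨ cong (_% p) (*-comm ((p ∸ 1) !) _) ⟩
    (a ^ (p ∸ 1) * (p ∸ 1) !) % p  ≡⟨ product-multiples a (p ∸ 1) ⟨
    product (map (λ j → (a * j) % p) (downFrom⁺ (p ∸ 1))) % p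
                                   ≡⟨ cong (_% p) (product-↭ (↭-multiples p∤a)) ⟩
    product (downFrom⁺ (p ∸ 1)) % p ≡⟨ cong (_% p) (trans (product-downFrom⁺ (p ∸ 1)) (sym (*-identityʳ _))) ⟩
    ((p ∸ 1) ! * 1) % p            ∎)
    where open ≡-Reasoning

  x*[p∸1]+x≈0 : ∀ x → x * (p ∸ 1) + x ≈ 0
  x*[p∸1]+x≈0 x = ∣⇒≈0 (divides x (begin
    x * (p ∸ 1) + x  ≡⟨ +-comm (x * (p ∸ 1)) x ⟩
    x + x * (p ∸ 1)  ≡⟨ *-suc x (p ∸ 1) ⟨
    x * suc (p ∸ 1)  ≡⟨ cong (x *_) suc[p∸1]≡p ⟩
    x * p            ∎))
    where open ≡-Reasoning

  [p∸1]²≈1 : (p ∸ 1) * (p ∸ 1) ≈ 1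
  [p∸1]²≈1 = begin
    (q * q) % p           ≡⟨ ≈-+-multiple (q * q) 1 ⟨
    (q * q + 1 * p) % p   ≡⟨ cong (λ u → (q * q + 1 * u) % p) (sym suc[p∸1]≡p) ⟩
    (q * q + 1 * suc q) % p ≡⟨ cong (_% p) (rearrange q) ⟩
    (q * q + q + 1) % p   ≡⟨ +-cong (x*[p∸1]+x≈0 q) (refl {x = 1 % p}) ⟩
    1 % p                 ∎
    where
    open ≡-Reasoning
    q = p ∸ 1
    rearrange : ∀ q → q * q + 1 * suc q ≡ q * q + q + 1
    rearrange = solve-∀

  square≈1 : ∀ {x} → 1 ≤ x → x < p → x * x ≈ 1 → x ≡ 1 ⊎ x ≡ p ∸ 1
  square≈1 {suc zero} _ _ _ = inj₁ refl
  square≈1 {suc (suc y)} _ x<p x²≈1 with euclidsLemma (suc y) (suc (suc (suc y))) prime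
    (subst (p ∣_) (sym (*-suc (suc y) (suc (suc y)))) (≈⇒∣∸ (s≤s z≤n) (sym x²≈1)))
  ... | inj₁ p∣x∸1 = ⊥-elim (<⇒≱ (<-trans (n<1+n _) x<p) (∣⇒≤ p∣x∸1))
  ... | inj₂ p∣x+1 = inj₂ (suc-injective (trans (≤-antisym x<p (∣⇒≤ p∣x+1)) (sym suc[p∸1]≡p)))

  inverse : ℕ → ℕ
  inverse x = (x ^ (p ∸ 2)) % p

  *-inverse : ∀ {x} → p ∤ x → x * inverse x ≈ 1
  *-inverse {x} p∤x = begin
    (x * inverse x) % p    ≡⟨ *-congˡ x (%-≈ (x ^ (p ∸ 2))) ⟩
    (x ^ suc (p ∸ 2)) % p  ≡⟨ cong (λ n → (x ^ n) % p) (+-∸-assoc 1 1<p) ⟨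
    (x ^ (p ∸ 1)) % p      ≡⟨ fermat p∤x ⟩
    1 % p                  ∎
    where open ≡-Reasoning

  ≈1⇒∤ʳ : ∀ {x y} → x * y ≈ 1 → p ∤ y
  ≈1⇒∤ʳ {x} xy≈1 p∣y = <⇒≢ 1<p (sym (∣1⇒≡1 (≈0⇒∣ (trans (sym xy≈1) (∣⇒≈0 (∣n⇒∣m*n x p∣y))))))

  inverse-unique : ∀ {x y} → p ∤ x → x * y ≈ 1 → y ≈ inverse x
  inverse-unique {x} {y} p∤x xy≈1 = *-cancelˡ-≈ p∤x (trans xy≈1 (sym (*-inverse p∤x)))

  inverse-involutive : ∀ {x} → p ∤ x → x < p → inverse (inverse x) ≡ x
  inverse-involutive {x} p∤x x<p = ≈∧<⇒≡ (m%n<n _ p) x<p (sym (inverse-unique (≈1⇒∤ʳ {x} (*-inverse p∤x))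
    (trans (cong (_% p) (*-comm (inverse x) x)) (*-inverse p∤x))))

  inverse-1 : inverse 1 ≡ 1
  inverse-1 = trans (cong (_% p) (^-zeroˡ (p ∸ 2))) (m<n⇒m%n≡m 1<p)

  inverse-[p∸1] : inverse (p ∸ 1) ≡ p ∸ 1
  inverse-[p∸1] = ≈∧<⇒≡ (m%n<n _ p) p∸1<p (sym (inverse-unique (∤-< p∸1≥1 p∸1<p) [p∸1]²≈1))
    where
    p∸1<p = ≤-reflexive suc[p∸1]≡p
    p∸1≥1 = <p⇒≤p∸1 1<p

  p∸1≡suc[p∸2] : p ∸ 1 ≡ suc (p ∸ 2)
  p∸1≡suc[p∸2] = +-∸-assoc 1 1<p

  private
    Middle : ℕ → Set
    Middle z = 2 ≤ z × z ≤ p ∸ 2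

    middle⇒<p : ∀ {z} → Middle z → z < p
    middle⇒<p (_ , z≤) = ≤-trans (s≤s (≤-trans z≤ (∸-monoʳ-≤ p (s≤s z≤n)))) (≤-reflexive suc[p∸1]≡p)

    middle⇒∤ : ∀ {z} → Middle z → p ∤ z
    middle⇒∤ z∈ = ∤-< (<⇒≤ (proj₁ z∈)) (middle⇒<p z∈)

    middle⇒≢p∸1 : ∀ {z} → Middle z → z ≢ p ∸ 1
    middle⇒≢p∸1 (_ , z≤) z≡p∸1 = <⇒≱ (subst (p ∸ 2 <_) (sym p∸1≡suc[p∸2]) ≤-refl) (subst (_≤ p ∸ 2) z≡p∸1 z≤)

    -- 1 and p − 1 are their own inverses, so the involution `inverse` cannot send z to them.
    inverse-middle : ∀ {z} → Middle z → Middle (inverse z)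
    inverse-middle {z} z∈ = ≤∧≢⇒< (∤⇒≥1 (≈1⇒∤ʳ {z} (*-inverse (middle⇒∤ z∈)))) (≢1 ∘ sym) , ≤p∸2
      where
      involutive = inverse-involutive (middle⇒∤ z∈) (middle⇒<p z∈)
      ≢1 : inverse z ≢ 1
      ≢1 inv≡1 = <⇒≢ (proj₁ z∈) (sym (trans (sym involutive) (trans (cong inverse inv≡1) inverse-1)))
      ≢p∸1 : inverse z ≢ p ∸ 1
      ≢p∸1 inv≡p∸1 = middle⇒≢p∸1 z∈ (trans (sym involutive) (trans (cong inverse inv≡p∸1) inverse-[p∸1]))
      ≤p∸2 : inverse z ≤ p ∸ 2
      ≤p∸2 = subst (inverse z ≤_) (∸-+-assoc p 1 1) (<⇒≤pred (≤∧≢⇒< (<p⇒≤p∸1 (m%n<n _ p)) ≢p∸1))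

    inverse-no-fixed-point : ∀ {z} → Middle z → inverse z ≢ z
    inverse-no-fixed-point {z} z∈ inv≡z with square≈1 (<⇒≤ (proj₁ z∈)) (middle⇒<p z∈)
                                              (subst (λ y → z * y ≈ 1) inv≡z (*-inverse (middle⇒∤ z∈)))
    ... | inj₁ refl = <-irrefl refl (proj₁ z∈)
    ... | inj₂ z≡p∸1 = middle⇒≢p∸1 z∈ z≡p∸1

    middles : List ℕ
    middles = remove 1 (downFrom⁺ (p ∸ 2))

    ∈-middles⁻ : ∀ {z} → z ∈ middles → Middle z
    ∈-middles⁻ z∈ with 1≤z , z≤ ← ∈-downFrom⁺⁻ (∈-remove⁻ 1 z∈) =
      ≤∧≢⇒< 1≤z (All.lookup (∉-remove 1 (Unique-downFrom⁺ (p ∸ 2))) z∈) , z≤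

    ∈-middles⁺ : ∀ {z} → Middle z → z ∈ middles
    ∈-middles⁺ (2≤z , z≤) = ∈-remove⁺ 1 (∈-downFrom⁺⁺ (<⇒≤ 2≤z , z≤)) λ z≡1 → <⇒≢ 2≤z (sym z≡1)

    [p∸2]!≈1 : 3 ≤ p → (p ∸ 2) ! ≈ 1
    [p∸2]!≈1 3≤p with m , _ , product≈ ← product-involution inverse 1 (Unique-remove 1 (Unique-downFrom⁺ (p ∸ 2)))
        (∈-middles⁺ ∘ inverse-middle ∘ ∈-middles⁻)
        (λ z∈ → inverse-involutive (middle⇒∤ (∈-middles⁻ z∈)) (middle⇒<p (∈-middles⁻ z∈)))
        (inverse-no-fixed-point ∘ ∈-middles⁻) (*-inverse ∘ middle⇒∤ ∘ ∈-middles⁻) = begin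
      (p ∸ 2) ! % p                   ≡⟨ cong (_% p) (product-downFrom⁺ (p ∸ 2)) ⟨
      product (downFrom⁺ (p ∸ 2)) % p ≡⟨ cong (_% p) (product-↭ (↭-remove 1 1∈)) ⟩
      (1 * product middles) % p       ≡⟨ cong (_% p) (*-identityˡ _) ⟩
      product middles % p             ≡⟨ product≈ ⟩
      (1 ^ m) % p                     ≡⟨ cong (_% p) (^-zeroˡ m) ⟩
      1 % p                           ∎
      where
      open ≡-Reasoning
      1∈ : 1 ∈ downFrom⁺ (p ∸ 2)
      1∈ = ∈-downFrom⁺⁺ (≤-refl , ∸-monoˡ-≤ 2 3≤p)

  wilson : (p ∸ 1) ! ≈ p ∸ 1
  wilson with 3 ≤? p
  ... | yes 3≤p = begin
    (p ∸ 1) ! % p                 ≡⟨ cong (λ n → n ! % p) p∸1≡suc[p∸2] ⟩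
    (suc (p ∸ 2) * (p ∸ 2) !) % p ≡⟨ cong (λ n → (n * (p ∸ 2) !) % p) (sym p∸1≡suc[p∸2]) ⟩
    ((p ∸ 1) * (p ∸ 2) !) % p     ≡⟨ *-congˡ (p ∸ 1) ([p∸2]!≈1 3≤p) ⟩
    ((p ∸ 1) * 1) % p             ≡⟨ cong (_% p) (*-identityʳ _) ⟩
    (p ∸ 1) % p                   ∎
    where open ≡-Reasoning
  ... | no p≱3 = cong (_% p) (subst (λ n → (n ∸ 1) ! ≡ n ∸ 1) (sym p≡2) refl)
    where
    p≡2 : p ≡ 2
    p≡2 = ≤-antisym (≤-pred (≰⇒> p≱3)) 1<p

-- Signs

-1^_ : ℕ → ℤ
-1^ n = -1ℤ ℤ.^ n

-1^-+ : ∀ m n → -1^ (m + n) ≡ -1^ m ℤ.* -1^ n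
-1^-+ = ℤₚ.^-distribˡ-+-* -1ℤ

-1^-cases : ∀ n → -1^ n ≡ 1ℤ ⊎ -1^ n ≡ -1ℤ
-1^-cases zero = inj₁ refl
-1^-cases (suc n) with -1^-cases n
... | inj₁ e = inj₂ (cong (-1ℤ ℤ.*_) e)
... | inj₂ e = inj₁ (cong (-1ℤ ℤ.*_) e)

-1^n*-1^n≡1 : ∀ n → -1^ n ℤ.* -1^ n ≡ 1ℤ
-1^n*-1^n≡1 n with -1^-cases n
... | inj₁ e rewrite e = refl
... | inj₂ e rewrite e = refl

-1^-even : ∀ n → -1^ (n + n) ≡ 1ℤ
-1^-even n = trans (-1^-+ n n) (-1^n*-1^n≡1 n)

-1^-odd* : ∀ c n → -1^ (suc (c + c) * n) ≡ -1^ n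
-1^-odd* c n = begin
  -1^ (n + (c + c) * n)         ≡⟨ cong (λ k → -1^ (n + k)) (*-distribʳ-+ n c c) ⟩
  -1^ (n + (c * n + c * n))     ≡⟨ -1^-+ n _ ⟩
  -1^ n ℤ.* -1^ (c * n + c * n) ≡⟨ cong (-1^ n ℤ.*_) (-1^-even (c * n)) ⟩
  -1^ n ℤ.* 1ℤ                  ≡⟨ ℤₚ.*-identityʳ _ ⟩
  -1^ n                         ∎
  where open ≡-Reasoning

-1^-cancelˡ : ∀ n {x y} → -1^ n ℤ.* x ≡ -1^ n ℤ.* y → x ≡ y
-1^-cancelˡ n {x} {y} eq = begin
  x                          ≡⟨ ℤₚ.*-identityˡ x ⟨
  1ℤ ℤ.* x                   ≡⟨ cong (ℤ._* x) (-1^n*-1^n≡1 n) ⟨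
  -1^ n ℤ.* -1^ n ℤ.* x      ≡⟨ ℤₚ.*-assoc (-1^ n) _ x ⟩
  -1^ n ℤ.* (-1^ n ℤ.* x)    ≡⟨ cong (-1^ n ℤ.*_) eq ⟩
  -1^ n ℤ.* (-1^ n ℤ.* y)    ≡⟨ ℤₚ.*-assoc (-1^ n) _ y ⟨
  -1^ n ℤ.* -1^ n ℤ.* y      ≡⟨ cong (ℤ._* y) (-1^n*-1^n≡1 n) ⟩
  1ℤ ℤ.* y                   ≡⟨ ℤₚ.*-identityˡ y ⟩
  y                          ∎
  where open ≡-Reasoning

-1^-≡ : ∀ {m n} → 1ℤ ≡ -1^ m ℤ.* -1^ n → -1^ m ≡ -1^ n
-1^-≡ {m} {n} eq = -1^-cancelˡ m (trans (-1^n*-1^n≡1 m) eq)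

m+m≡n+n⇒m≡n : ∀ {m n} → m + m ≡ n + n → m ≡ n
m+m≡n+n⇒m≡n {m} {n} eq = *-cancelˡ-≡ m n 2
  (trans (cong (m +_) (+-identityʳ m)) (trans eq (sym (cong (n +_) (+-identityʳ n)))))

-- Euler's criterion and Gauss's lemma

module OddPrime {p h : ℕ} (prime : Prime p) (p≡2h+1 : p ≡ suc (h + h)) where

  open PrimeModulus prime public

  h+h≡p∸1 : h + h ≡ p ∸ 1
  h+h≡p∸1 = cong pred (sym p≡2h+1)

  euler-square : ∀ {a} → p ∤ a → IsSquare a → a ^ h ≈ 1
  euler-square {a} p∤a (y , y²≈a) = begin
    (a ^ h) % p           ≡⟨ ^-cong h (sym y²≈a) ⟩
    ((y * y) ^ h) % p     ≡⟨ cong (λ z → (z ^ h) % p) (cong (y *_) (*-identityʳ y)) ⟨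
    ((y ^ 2) ^ h) % p     ≡⟨ cong (_% p) (^-*-assoc y 2 h) ⟩
    (y ^ (2 * h)) % p     ≡⟨ cong (λ n → (y ^ (h + n)) % p) (+-identityʳ h) ⟩
    (y ^ (h + h)) % p     ≡⟨ cong (λ n → (y ^ n) % p) h+h≡p∸1 ⟩
    (y ^ (p ∸ 1)) % p     ≡⟨ fermat p∤y ⟩
    1 % p                 ∎
    where
    open ≡-Reasoning
    p∤y : p ∤ y
    p∤y p∣y = p∤a (≈0⇒∣ (trans (sym y²≈a) (∣⇒≈0 (∣m⇒∣m*n y p∣y))))

  private
    module DivisionPairing {a : ℕ} (p∤a : p ∤ a) where

      f : ℕ → ℕ
      f x = (a * inverse x) % p

      <p : ∀ {x} → x ∈ downFrom⁺ (p ∸ 1) → x < p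
      <p x∈ = ≤-trans (s≤s (proj₂ (∈-downFrom⁺⁻ x∈))) (≤-reflexive suc[p∸1]≡p)

      p∤ : ∀ {x} → x ∈ downFrom⁺ (p ∸ 1) → p ∤ x
      p∤ x∈ = ∤-< (proj₁ (∈-downFrom⁺⁻ x∈)) (<p x∈)

      p∤f : ∀ {x} → x ∈ downFrom⁺ (p ∸ 1) → p ∤ f x
      p∤f {x} x∈ = ∤-% (∤-* p∤a (≈1⇒∤ʳ {x} (*-inverse (p∤ x∈))))

      closed : ∀ {x} → x ∈ downFrom⁺ (p ∸ 1) → f x ∈ downFrom⁺ (p ∸ 1)
      closed x∈ = ∈-downFrom⁺⁺ (∤⇒≥1 (p∤f x∈) , <p⇒≤p∸1 (m%n<n _ p))

      pairs : ∀ {x} → x ∈ downFrom⁺ (p ∸ 1) → x * f x ≈ a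
      pairs {x} x∈ = begin
        (x * f x) % p               ≡⟨ *-congˡ x (%-≈ (a * inverse x)) ⟩
        (x * (a * inverse x)) % p   ≡⟨ cong (_% p) (x∙[a∙y]≡a∙[x∙y] x a (inverse x)) ⟩
        (a * (x * inverse x)) % p   ≡⟨ *-congˡ a (*-inverse (p∤ x∈)) ⟩
        (a * 1) % p                 ≡⟨ cong (_% p) (*-identityʳ a) ⟩
        a % p                       ∎
        where
        open ≡-Reasoning
        x∙[a∙y]≡a∙[x∙y] : ∀ x a y → x * (a * y) ≡ a * (x * y)
        x∙[a∙y]≡a∙[x∙y] = solve-∀

      involutive : ∀ {x} → x ∈ downFrom⁺ (p ∸ 1) → f (f x) ≡ x
      involutive {x} x∈ = ≈∧<⇒≡ (m%n<n _ p) (<p x∈)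
        (*-cancelˡ-≈ (p∤f x∈) (trans (pairs (closed x∈)) (trans (sym (pairs x∈)) (cong (_% p) (*-comm x (f x))))))

  -- For a non-square a, x ↦ a x⁻¹ pairs up 1, …, p − 1 without fixed points; then apply Wilson.
  euler-nonsquare : ∀ {a} → p ∤ a → ¬ IsSquare a → a ^ h ≈ p ∸ 1
  euler-nonsquare {a} p∤a ¬□a = begin
      (a ^ h) % p                     ≡⟨ cong (λ n → (a ^ n) % p) m≡h ⟨
      (a ^ m) % p                     ≡⟨ proj₂ (proj₂ pairing) ⟨
      product (downFrom⁺ (p ∸ 1)) % p ≡⟨ cong (_% p) (product-downFrom⁺ (p ∸ 1)) ⟩
      (p ∸ 1) ! % p                   ≡⟨ wilson ⟩
      (p ∸ 1) % p                     ∎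
    where
    open ≡-Reasoning
    open DivisionPairing p∤a

    no-fixed-point : ∀ {x} → x ∈ downFrom⁺ (p ∸ 1) → f x ≢ x
    no-fixed-point {x} x∈ fx≡x = ¬□a (x , subst (λ y → x * y ≈ a) fx≡x (pairs x∈))

    pairing = product-involution f a (Unique-downFrom⁺ (p ∸ 1)) closed involutive no-fixed-point pairs
    m = proj₁ pairing

    m≡h : m ≡ h
    m≡h = m+m≡n+n⇒m≡n (trans (proj₁ (proj₂ pairing)) (trans (length-applyDownFrom suc (p ∸ 1)) (sym h+h≡p∸1)))

  euler-criterion : ∀ {a} → p ∤ a →
    (legendre a p ≡ 1ℤ × a ^ h ≈ 1) ⊎ (legendre a p ≡ -1ℤ × a ^ h ≈ p ∸ 1)
  euler-criterion p∤a with legendre-∤ p p∤a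
  ... | inj₁ (a↦1 , □a) = inj₁ (a↦1 , euler-square p∤a □a)
  ... | inj₂ (a↦-1 , ¬□a) = inj₂ (a↦-1 , euler-nonsquare p∤a ¬□a)

  1≉p∸1 : ¬ (1 ≈ p ∸ 1)
  1≉p∸1 1≈p∸1 = <⇒≢ 1<p∸1 (≈∧<⇒≡ 1<p (≤-reflexive suc[p∸1]≡p) 1≈p∸1)
    where
    1<p∸1 : 1 < p ∸ 1
    1<p∸1 = subst (1 <_) h+h≡p∸1 (1<h+h h (subst (1 <_) p≡2h+1 1<p))
      where
      1<h+h : ∀ h → 1 < suc (h + h) → 1 < h + h
      1<h+h zero (s≤s ())
      1<h+h (suc h) _ = s≤s (subst (1 ≤_) (sym (+-suc h h)) (s≤s z≤n))

  [p∸1]^-cases : ∀ n → (-1^ n ≡ 1ℤ × (p ∸ 1) ^ n ≈ 1) ⊎ (-1^ n ≡ -1ℤ × (p ∸ 1) ^ n ≈ p ∸ 1)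
  [p∸1]^-cases zero = inj₁ (refl , refl)
  [p∸1]^-cases (suc n) with [p∸1]^-cases n
  ... | inj₁ (sign , power) = inj₂ (cong (-1ℤ ℤ.*_) sign , trans (*-congˡ (p ∸ 1) power) (cong (_% p) (*-identityʳ _)))
  ... | inj₂ (sign , power) = inj₁ (cong (-1ℤ ℤ.*_) sign , trans (*-congˡ (p ∸ 1) power) [p∸1]²≈1)

  legendre-≈-power : ∀ {c} n → p ∤ c → c ^ h ≈ (p ∸ 1) ^ n → legendre c p ≡ -1^ n
  legendre-≈-power n p∤c c^h≈ with euler-criterion p∤c | [p∸1]^-cases n
  ... | inj₁ (c↦1 , _) | inj₁ (sign , _) = trans c↦1 (sym sign)
  ... | inj₂ (c↦-1 , _) | inj₂ (sign , _) = trans c↦-1 (sym sign)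
  ... | inj₁ (_ , c^h≈1) | inj₂ (_ , power) = ⊥-elim (1≉p∸1 (trans (sym c^h≈1) (trans c^h≈ power)))
  ... | inj₂ (_ , c^h≈-1) | inj₁ (_ , power) = ⊥-elim (1≉p∸1 (trans (sym power) (trans (sym c^h≈) c^h≈-1)))

  legendre-as-power : ∀ {c} → p ∤ c → ∃ λ n → legendre c p ≡ -1^ n × c ^ h ≈ (p ∸ 1) ^ n
  legendre-as-power p∤c with euler-criterion p∤c
  ... | inj₁ (c↦1 , c^h≈1) = 0 , c↦1 , c^h≈1
  ... | inj₂ (c↦-1 , c^h≈-1) = 1 , c↦-1 , trans c^h≈-1 (cong (_% p) (sym (*-identityʳ (p ∸ 1))))

  legendre-* : ∀ a b → legendre (a * b) p ≡ legendre a p ℤ.* legendre b p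
  legendre-* a b with p ∣? a | p ∣? b
  ... | yes p∣a | _ = begin
    legendre (a * b) p            ≡⟨ legendre-∣ p (∣m⇒∣m*n b p∣a) ⟩
    0ℤ                            ≡⟨ ℤₚ.*-zeroˡ (legendre b p) ⟨
    0ℤ ℤ.* legendre b p           ≡⟨ cong (ℤ._* legendre b p) (legendre-∣ p p∣a) ⟨
    legendre a p ℤ.* legendre b p ∎
    where open ≡-Reasoning
  ... | no _ | yes p∣b = begin
    legendre (a * b) p            ≡⟨ legendre-∣ p (∣n⇒∣m*n a p∣b) ⟩
    0ℤ                            ≡⟨ ℤₚ.*-zeroʳ (legendre a p) ⟨
    legendre a p ℤ.* 0ℤ           ≡⟨ cong (legendre a p ℤ.*_) (legendre-∣ p p∣b) ⟨
    legendre a p ℤ.* legendre b p ∎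
    where open ≡-Reasoning
  ... | no p∤a | no p∤b
    with m , a↦ , a^h≈ ← legendre-as-power p∤a | n , b↦ , b^h≈ ← legendre-as-power p∤b = begin
    legendre (a * b) p            ≡⟨ legendre-≈-power (m + n) (∤-* p∤a p∤b) ab^h≈ ⟩
    -1^ (m + n)                   ≡⟨ -1^-+ m n ⟩
    -1^ m ℤ.* -1^ n               ≡⟨ cong₂ ℤ._*_ a↦ b↦ ⟨
    legendre a p ℤ.* legendre b p ∎
    where
    open ≡-Reasoning
    ab^h≈ : (a * b) ^ h ≈ (p ∸ 1) ^ (m + n)
    ab^h≈ = begin
      ((a * b) ^ h) % p                    ≡⟨ cong (_% p) (^-distrib-* a b h) ⟩
      (a ^ h * b ^ h) % p                  ≡⟨ *-cong a^h≈ b^h≈ ⟩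
      ((p ∸ 1) ^ m * (p ∸ 1) ^ n) % p      ≡⟨ cong (_% p) (^-distribˡ-+-* (p ∸ 1) m n) ⟨
      ((p ∸ 1) ^ (m + n)) % p              ∎

  legendre-[p∸1] : legendre (p ∸ 1) p ≡ -1^ h
  legendre-[p∸1] = legendre-≈-power h (∤-< (<p⇒≤p∸1 1<p) (≤-reflexive suc[p∸1]≡p)) refl

  ≤h⇒<p : ∀ {j} → j ≤ h → j < p
  ≤h⇒<p j≤h = ≤-trans (s≤s (≤-trans j≤h (m≤m+n h h))) (≤-reflexive (sym p≡2h+1))

  [p∸1]*[p∸x]≈x : ∀ {x} → x < p → (p ∸ 1) * (p ∸ x) ≈ x
  [p∸1]*[p∸x]≈x {x} x<p = begin
    ((p ∸ 1) * (p ∸ x)) % p                    ≡⟨ ≈-+-multiple _ 1 ⟨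
    ((p ∸ 1) * (p ∸ x) + 1 * p) % p            ≡⟨ cong (λ u → ((p ∸ 1) * (p ∸ x) + u) % p) (+-identityʳ p) ⟩
    ((p ∸ 1) * (p ∸ x) + p) % p                ≡⟨ cong (λ u → ((p ∸ 1) * (p ∸ x) + u) % p) (m∸n+n≡m (<⇒≤ x<p)) ⟨
    ((p ∸ 1) * (p ∸ x) + ((p ∸ x) + x)) % p    ≡⟨ cong (_% p) (+-assoc _ (p ∸ x) x) ⟨
    ((p ∸ 1) * (p ∸ x) + (p ∸ x) + x) % p      ≡⟨ +-cong (trans (cong (λ u → (u + (p ∸ x)) % p) (*-comm (p ∸ 1) (p ∸ x)))
                                                                   (x*[p∸1]+x≈0 (p ∸ x)))
                                                            (refl {x = x % p}) ⟩
    x % p                                      ∎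
    where open ≡-Reasoning

  module Gauss {a : ℕ} (p∤a : p ∤ a) where

    r : ℕ → ℕ
    r j = (a * j) % p

    -- |least absolute residue| of a residue x ∈ [1, p − 1]
    reflect : ℕ → ℕ
    reflect x with x ≤? h
    ... | yes _ = x
    ... | no _ = p ∸ x

    count-large : List ℕ → ℕ
    count-large [] = 0
    count-large (j ∷ js) with r j ≤? h
    ... | yes _ = count-large js
    ... | no _ = suc (count-large js)

    μ : ℕ
    μ = count-large (downFrom⁺ h)

    product-reflect : ∀ js → product (map r js) ≈ (p ∸ 1) ^ count-large js * product (map (reflect ∘ r) js)
    product-reflect [] = refl
    product-reflect (j ∷ js) with r j ≤? h
    ... | yes _ = begin
      (r j * product (map r js)) % p        ≡⟨ *-congˡ (r j) (product-reflect js) ⟩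
      (r j * ((p ∸ 1) ^ μ′ * P)) % p        ≡⟨ cong (_% p) (x∙[y∙z]≡y∙[x∙z] (r j) ((p ∸ 1) ^ μ′) P) ⟩
      ((p ∸ 1) ^ μ′ * (r j * P)) % p        ∎
      where
      open ≡-Reasoning
      μ′ = count-large js
      P = product (map (reflect ∘ r) js)
      x∙[y∙z]≡y∙[x∙z] : ∀ x y z → x * (y * z) ≡ y * (x * z)
      x∙[y∙z]≡y∙[x∙z] = solve-∀
    ... | no _ = begin
      (r j * product (map r js)) % p                 ≡⟨ *-cong (sym ([p∸1]*[p∸x]≈x (m%n<n _ p))) (product-reflect js) ⟩
      ((p ∸ 1) * (p ∸ r j) * ((p ∸ 1) ^ μ′ * P)) % p ≡⟨ cong (_% p) (interchange (p ∸ 1) (p ∸ r j) ((p ∸ 1) ^ μ′) P) ⟩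
      ((p ∸ 1) * (p ∸ 1) ^ μ′ * ((p ∸ r j) * P)) % p ∎
      where
      open ≡-Reasoning
      μ′ = count-large js
      P = product (map (reflect ∘ r) js)
      interchange : ∀ a b c d → a * b * (c * d) ≡ a * c * (b * d)
      interchange = solve-∀

    private
      p∤* : ∀ {j} → InRange h j → p ∤ a * j
      p∤* (1≤j , j≤h) = ∤-* p∤a (∤-< 1≤j (≤h⇒<p j≤h))

      r+r≢p : ∀ {i j} → InRange h i → InRange h j → r i + r j ≢ p
      r+r≢p {i} {j} (1≤i , i≤h) (1≤j , j≤h) ri+rj≡p = ∤-* p∤a p∤i+j (≈0⇒∣ (begin
        (a * (i + j)) % p       ≡⟨ cong (_% p) (*-distribˡ-+ a i j) ⟩
        (a * i + a * j) % p     ≡⟨ +-cong (sym (%-≈ (a * i))) (sym (%-≈ (a * j))) ⟩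
        (r i + r j) % p         ≡⟨ cong (_% p) ri+rj≡p ⟩
        p % p                   ≡⟨ n%n≡0 p ⟩
        0                       ≡⟨ 0%p≡0 ⟨
        0 % p                   ∎))
        where
        open ≡-Reasoning
        p∤i+j = ∤-< (≤-trans 1≤i (m≤m+n i j)) (≤-trans (s≤s (+-mono-≤ i≤h j≤h)) (≤-reflexive (sym p≡2h+1)))

      r-injective : ∀ {i j} → InRange h i → InRange h j → r i ≡ r j → i ≡ j
      r-injective (_ , i≤h) (_ , j≤h) ri≡rj = ≈∧<⇒≡ (≤h⇒<p i≤h) (≤h⇒<p j≤h) (*-cancelˡ-≈ p∤a ri≡rj)

    reflect-InRange : ∀ {j} → InRange h j → InRange h (reflect (r j))
    reflect-InRange {j} j∈ with r j ≤? h
    ... | yes rj≤h = ∤⇒≥1 (∤-% (p∤* j∈)) , rj≤h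
    ... | no rj≰h = m<n⇒0<n∸m (m%n<n _ p) ,
      m≤n+o⇒m∸n≤o p (r j) (subst (_≤ r j + h) (sym p≡2h+1) (+-monoˡ-≤ h (≰⇒> rj≰h)))

    reflect-injective : ∀ {i j} → InRange h i → InRange h j → reflect (r i) ≡ reflect (r j) → i ≡ j
    reflect-injective {i} {j} i∈ j∈ eq with r i ≤? h | r j ≤? h
    ... | yes _ | yes _ = r-injective i∈ j∈ eq
    ... | no _ | no _ = r-injective i∈ j∈
      (trans (sym (m∸[m∸n]≡n (<⇒≤ (m%n<n _ p)))) (trans (cong (p ∸_) eq) (m∸[m∸n]≡n (<⇒≤ (m%n<n _ p)))))
    ... | yes _ | no _ = ⊥-elim (r+r≢p i∈ j∈ (trans (cong (_+ r j) eq) (m∸n+n≡m (<⇒≤ (m%n<n _ p)))))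
    ... | no _ | yes _ = ⊥-elim (r+r≢p i∈ j∈
      (trans (+-comm (r i) (r j)) (trans (cong (_+ r i) (sym eq)) (m∸n+n≡m (<⇒≤ (m%n<n _ p))))))

    ↭-reflect : map (reflect ∘ r) (downFrom⁺ h) ↭ downFrom⁺ h
    ↭-reflect = ↭-downFrom⁺-image h (reflect ∘ r) reflect-InRange reflect-injective

    a^h≈[p∸1]^μ : a ^ h ≈ (p ∸ 1) ^ μ
    a^h≈[p∸1]^μ = *-cancelˡ-≈ (∤-! (≤h⇒<p ≤-refl)) (begin
      (h ! * a ^ h) % p                        ≡⟨ cong (_% p) (*-comm (h !) (a ^ h)) ⟩
      (a ^ h * h !) % p                        ≡⟨ product-multiples a h ⟨
      product (map r (downFrom⁺ h)) % p        ≡⟨ product-reflect (downFrom⁺ h) ⟩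
      ((p ∸ 1) ^ μ * product (map (reflect ∘ r) (downFrom⁺ h))) % p
                                               ≡⟨ cong (λ u → ((p ∸ 1) ^ μ * u) % p)
                                                    (trans (product-↭ ↭-reflect) (product-downFrom⁺ h)) ⟩
      ((p ∸ 1) ^ μ * h !) % p                  ≡⟨ cong (_% p) (*-comm ((p ∸ 1) ^ μ) (h !)) ⟩
      (h ! * (p ∸ 1) ^ μ) % p                  ∎)
      where open ≡-Reasoning

    gauss-lemma : legendre a p ≡ -1^ μ
    gauss-lemma = legendre-≈-power μ p∤a a^h≈[p∸1]^μ

    module _ {c : ℕ} (a≡2c+1 : a ≡ suc (c + c)) where

      private
        q : ℕ → ℕ
        q j = (a * j) / p

        Q = sum (map q (downFrom⁺ h))

        sum-division : ∀ js → a * sum js ≡ sum (map r js) + sum (map q js) * p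
        sum-division [] = *-zeroʳ a
        sum-division (j ∷ js) = begin
          a * (j + sum js)                                            ≡⟨ *-distribˡ-+ a j (sum js) ⟩
          a * j + a * sum js                                          ≡⟨ cong₂ _+_ (m≡m%n+[m/n]*n (a * j) p) (sum-division js) ⟩
          r j + q j * p + (sum (map r js) + sum (map q js) * p)
                                                                      ≡⟨ rearrange (r j) (q j) p _ _ ⟩
          r j + sum (map r js) + (q j + sum (map q js)) * p ∎
          where
          open ≡-Reasoning
          rearrange : ∀ x y p u v → x + y * p + (u + v * p) ≡ x + u + (y + v) * p
          rearrange = solve-∀

        sum-reflect : ∀ js → ∃ λ B → sum (map r js) + (B + B) ≡ sum (map (reflect ∘ r) js) + count-large js * p
        sum-reflect [] = 0 , refl
        sum-reflect (j ∷ js) with r j ≤? h | sum-reflect js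
        ... | yes _ | B , eq = B , trans (+-assoc (r j) _ (B + B)) (trans (cong (r j +_) eq) (sym (+-assoc (r j) _ _)))
        ... | no _ | B , eq = (p ∸ r j) + B , (begin
          r j + sum (map r js) + ((p ∸ r j + B) + (p ∸ r j + B))
            ≡⟨ rearrange₁ (r j) (sum (map r js)) (p ∸ r j) B ⟩
          (r j + (p ∸ r j)) + (p ∸ r j) + (sum (map r js) + (B + B))
            ≡⟨ cong₂ (λ u v → u + (p ∸ r j) + v) (m+[n∸m]≡n (<⇒≤ (m%n<n _ p))) eq ⟩
          p + (p ∸ r j) + (sum (map (reflect ∘ r) js) + count-large js * p)
            ≡⟨ rearrange₂ p (p ∸ r j) (sum (map (reflect ∘ r) js)) (count-large js * p) ⟩
          (p ∸ r j) + sum (map (reflect ∘ r) js) + (p + count-large js * p) ∎)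
          where
          open ≡-Reasoning
          rearrange₁ : ∀ x y z w → x + y + ((z + w) + (z + w)) ≡ (x + z) + z + (y + (w + w))
          rearrange₁ = solve-∀
          rearrange₂ : ∀ x y z w → x + y + (z + w) ≡ y + z + (x + w)
          rearrange₂ = solve-∀

        S = sum (downFrom⁺ h)
        R = sum (map r (downFrom⁺ h))
        B = proj₁ (sum-reflect (downFrom⁺ h))

        -- a·S reduced modulo p twice: by division, and through the reflected residues, which sum to S again.
        counting : a * S + (B + B) ≡ S + μ * p + Q * p
        counting = begin
          a * S + (B + B)          ≡⟨ cong (_+ (B + B)) (sum-division (downFrom⁺ h)) ⟩
          R + Q * p + (B + B)      ≡⟨ x+y+z≡x+z+y R (Q * p) (B + B) ⟩
          R + (B + B) + Q * p      ≡⟨ cong (_+ Q * p) (proj₂ (sum-reflect (downFrom⁺ h))) ⟩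
          sum (map (reflect ∘ r) (downFrom⁺ h)) + μ * p + Q * p
                                   ≡⟨ cong (λ u → u + μ * p + Q * p) (sum-↭ ↭-reflect) ⟩
          S + μ * p + Q * p        ∎
          where
          open ≡-Reasoning
          x+y+z≡x+z+y : ∀ x y z → x + y + z ≡ x + z + y
          x+y+z≡x+z+y = solve-∀

        -1^-*p : ∀ n → -1^ (n * p) ≡ -1^ n
        -1^-*p n = trans (cong -1^_ (trans (*-comm n p) (cong (_* n) p≡2h+1))) (-1^-odd* h n)

      eisenstein : -1^ μ ≡ -1^ sum (map (λ j → (a * j) / p) (downFrom⁺ h))
      eisenstein = -1^-≡ {μ} {Q} (-1^-cancelˡ S (begin
        -1^ S ℤ.* 1ℤ                               ≡⟨ cong₂ ℤ._*_ (trans (cong (λ u → -1^ (u * S)) a≡2c+1) (-1^-odd* c S))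
                                                                    (-1^-even B) ⟨
        -1^ (a * S) ℤ.* -1^ (B + B)                ≡⟨ -1^-+ (a * S) (B + B) ⟨
        -1^ (a * S + (B + B))                      ≡⟨ cong -1^_ counting ⟩
        -1^ (S + μ * p + Q * p)                    ≡⟨ trans (-1^-+ (S + μ * p) (Q * p)) (cong (ℤ._* -1^ (Q * p)) (-1^-+ S (μ * p))) ⟩
        -1^ S ℤ.* -1^ (μ * p) ℤ.* -1^ (Q * p)      ≡⟨ cong₂ (λ u v → -1^ S ℤ.* u ℤ.* v) (-1^-*p μ) (-1^-*p Q) ⟩
        -1^ S ℤ.* -1^ μ ℤ.* -1^ Q                  ≡⟨ ℤₚ.*-assoc (-1^ S) (-1^ μ) (-1^ Q) ⟩
        -1^ S ℤ.* (-1^ μ ℤ.* -1^ Q)                ∎))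
        where open ≡-Reasoning

-- Eisenstein's lattice count and quadratic reciprocity

sum-map-+ : ∀ (f g : ℕ → ℕ) xs → sum (map (λ x → f x + g x) xs) ≡ sum (map f xs) + sum (map g xs)
sum-map-+ f g [] = refl
sum-map-+ f g (x ∷ xs) = trans (cong (f x + g x +_) (sum-map-+ f g xs)) (interchange (f x) (g x) _ _)
  where
  interchange : ∀ a b c d → a + b + (c + d) ≡ a + c + (b + d)
  interchange = solve-∀

sum-map-const : ∀ c n → sum (map (λ _ → c) (downFrom⁺ n)) ≡ n * c
sum-map-const c zero = refl
sum-map-const c (suc n) = cong (c +_) (sum-map-const c n)

sum-map-cong-downFrom⁺ : ∀ {f g : ℕ → ℕ} n → (∀ {x} → InRange n x → f x ≡ g x) →
  sum (map f (downFrom⁺ n)) ≡ sum (map g (downFrom⁺ n))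
sum-map-cong-downFrom⁺ n f≗g = cong sum (map-cong-local (All.applyDownFrom⁺₁ suc n λ i<n → f≗g (s≤s z≤n , i<n)))

sum-map-swap : ∀ (g : ℕ → ℕ → ℕ) xs ys →
  sum (map (λ x → sum (map (g x) ys)) xs) ≡ sum (map (λ y → sum (map (λ x → g x y) xs)) ys)
sum-map-swap g [] ys = sym (sum-map-0 ys)
  where
  sum-map-0 : ∀ ys → sum (map (λ _ → 0) ys) ≡ 0
  sum-map-0 [] = refl
  sum-map-0 (_ ∷ ys) = sum-map-0 ys
sum-map-swap g (x ∷ xs) ys = trans (cong (sum (map (g x) ys) +_) (sum-map-swap g xs ys))
  (sym (sum-map-+ (g x) (λ y → sum (map (λ x → g x y) xs)) ys))

𝟙[_≤_] : ℕ → ℕ → ℕ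
𝟙[ x ≤ y ] with x ≤? y
... | yes _ = 1
... | no _ = 0

𝟙≤+𝟙≥ : ∀ {x y} → x ≢ y → 𝟙[ x ≤ y ] + 𝟙[ y ≤ x ] ≡ 1
𝟙≤+𝟙≥ {x} {y} x≢y with x ≤? y | y ≤? x
... | yes x≤y | yes y≤x = ⊥-elim (x≢y (≤-antisym x≤y y≤x))
... | yes _ | no _ = refl
... | no _ | yes _ = refl
... | no x≰y | no y≰x = ⊥-elim (x≰y (<⇒≤ (≰⇒> y≰x)))

count-multiples : ∀ d .{{_ : NonZero d}} x n → sum (map (λ i → 𝟙[ d * i ≤ x ]) (downFrom⁺ n)) ≡ n ⊓ (x / d)
count-multiples d x zero = refl
count-multiples d x (suc n) with d * suc n ≤? x
... | yes dn≤x = trans (cong suc (trans (count-multiples d x n) (m≤n⇒m⊓n≡m (<⇒≤ n<x/d))))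
                       (sym (m≤n⇒m⊓n≡m n<x/d))
  where
  n<x/d : suc n ≤ x / d
  n<x/d = subst (_≤ x / d) (trans (cong (_/ d) (*-comm d (suc n))) (m*n/n≡m (suc n) d)) (/-monoˡ-≤ d dn≤x)
... | no dn≰x = trans (count-multiples d x n) (trans (m≥n⇒m⊓n≡n x/d≤n) (sym (m≥n⇒m⊓n≡n (m≤n⇒m≤1+n x/d≤n))))
  where
  x/d≤n : x / d ≤ n
  x/d≤n = ≮⇒≥ λ n<x/d → dn≰x (≤-trans (≤-trans (≤-reflexive (*-comm d (suc n))) (*-monoˡ-≤ d n<x/d)) (m/n*n≤m x d))

⌊q*j/p⌋≤k : ∀ {p q h k j} .{{_ : NonZero p}} → p ≡ suc (h + h) → q ≡ suc (k + k) → j ≤ h → (q * j) / p ≤ k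
⌊q*j/p⌋≤k {p} {q} {h} {k} {j} p≡ q≡ j≤h = ≤-pred (m<n*o⇒m/o<n (≤-<-trans (*-monoʳ-≤ q j≤h)
  (subst₂ (λ p q → q * h < suc k * p) (sym p≡) (sym q≡) (qh<[k+1]p h k))))
  where
  qh<[k+1]p : ∀ h k → suc (k + k) * h < suc k * suc (h + h)
  qh<[k+1]p h k = subst₂ _≤_ (lhs h k) (rhs h k) (m≤m+n (suc (k * h + k * h + h)) (h + k))
    where
    lhs : ∀ h k → suc (k * h + k * h + h) ≡ suc (suc (k + k) * h)
    lhs = solve-∀
    rhs : ∀ h k → suc (k * h + k * h + h) + (h + k) ≡ suc k * suc (h + h)
    rhs = solve-∀

-- Eisenstein's lattice count: the points (j, i) of [1, h] × [1, k] lie on either side of the line p i = q j.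
lattice-count : ∀ {p q h k} .{{_ : NonZero p}} .{{_ : NonZero q}} → p ≡ suc (h + h) → q ≡ suc (k + k) →
  (∀ {i j} → InRange k i → InRange h j → p * i ≢ q * j) →
  sum (map (λ j → (q * j) / p) (downFrom⁺ h)) + sum (map (λ i → (p * i) / q) (downFrom⁺ k)) ≡ h * k
lattice-count {p} {q} {h} {k} p≡ q≡ off-line = begin
  sum (map (λ j → (q * j) / p) (downFrom⁺ h)) + sum (map (λ i → (p * i) / q) (downFrom⁺ k))
    ≡⟨ cong₂ _+_ (sum-map-cong-downFrom⁺ h λ {j} (_ , j≤h) → floor-count p (q * j) k (⌊q*j/p⌋≤k p≡ q≡ j≤h))
                 (sum-map-cong-downFrom⁺ k λ {i} (_ , i≤k) → floor-count q (p * i) h (⌊q*j/p⌋≤k q≡ p≡ i≤k)) ⟩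
  sum (map (λ j → sum (map (λ i → 𝟙[ p * i ≤ q * j ]) (downFrom⁺ k))) (downFrom⁺ h))
    + sum (map (λ i → sum (map (λ j → 𝟙[ q * j ≤ p * i ]) (downFrom⁺ h))) (downFrom⁺ k))
    ≡⟨ cong (sum (map (λ j → sum (map (λ i → 𝟙[ p * i ≤ q * j ]) (downFrom⁺ k))) (downFrom⁺ h)) +_)
            (sum-map-swap (λ i j → 𝟙[ q * j ≤ p * i ]) (downFrom⁺ k) (downFrom⁺ h)) ⟩
  sum (map (λ j → sum (map (λ i → 𝟙[ p * i ≤ q * j ]) (downFrom⁺ k))) (downFrom⁺ h))
    + sum (map (λ j → sum (map (λ i → 𝟙[ q * j ≤ p * i ]) (downFrom⁺ k))) (downFrom⁺ h))
    ≡⟨ sum-map-+ _ _ (downFrom⁺ h) ⟨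
  sum (map (λ j → sum (map (λ i → 𝟙[ p * i ≤ q * j ]) (downFrom⁺ k))
                + sum (map (λ i → 𝟙[ q * j ≤ p * i ]) (downFrom⁺ k))) (downFrom⁺ h))
    ≡⟨ sum-map-cong-downFrom⁺ h (λ j∈ → trans (sym (sum-map-+ _ _ (downFrom⁺ k)))
         (trans (sum-map-cong-downFrom⁺ k (λ i∈ → 𝟙≤+𝟙≥ (off-line i∈ j∈)))
                (trans (sum-map-const 1 k) (*-identityʳ k)))) ⟩
  sum (map (λ _ → k) (downFrom⁺ h))
    ≡⟨ sum-map-const k h ⟩
  h * k ∎
  where
  open ≡-Reasoning
  floor-count : ∀ d .{{_ : NonZero d}} x n → x / d ≤ n → x / d ≡ sum (map (λ i → 𝟙[ d * i ≤ x ]) (downFrom⁺ n))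
  floor-count d x n x/d≤n = sym (trans (count-multiples d x n) (m≥n⇒m⊓n≡n x/d≤n))

prime∤prime : ∀ {p q} → Prime p → Prime q → p ≢ q → p ∤ q
prime∤prime prime-p prime-q p≢q p∣q with prime⇒irreducible prime-q p∣q
... | inj₁ p≡1 = <⇒≢ (prime⇒1< prime-p) (sym p≡1)
... | inj₂ p≡q = p≢q p≡q

quadratic-reciprocity : ∀ {p q h k} → Prime p → Prime q → p ≢ q → p ≡ suc (h + h) → q ≡ suc (k + k) →
  legendre q p ℤ.* legendre p q ≡ -1^ (h * k)
quadratic-reciprocity {p} {q} {h} {k} prime-p prime-q p≢q p≡ q≡ = begin
  legendre q p ℤ.* legendre p q
    ≡⟨ cong₂ ℤ._*_ (trans GaussP.gauss-lemma (GaussP.eisenstein {k} q≡))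
                   (trans GaussQ.gauss-lemma (GaussQ.eisenstein {h} p≡)) ⟩
  -1^ Tp ℤ.* -1^ Tq ≡⟨ -1^-+ Tp Tq ⟨
  -1^ (Tp + Tq)     ≡⟨ cong -1^_ (lattice-count p≡ q≡ off-line) ⟩
  -1^ (h * k)       ∎
  where
  open ≡-Reasoning
  module P = OddPrime {h = h} prime-p p≡
  module Q = OddPrime {h = k} prime-q q≡
  module GaussP = P.Gauss (prime∤prime prime-p prime-q p≢q)
  module GaussQ = Q.Gauss (prime∤prime prime-q prime-p (p≢q ∘ sym))
  Tp = sum (map (λ j → (q * j) / p) (downFrom⁺ h))
  Tq = sum (map (λ i → (p * i) / q) (downFrom⁺ k))

  off-line : ∀ {i j} → InRange k i → InRange h j → p * i ≢ q * j
  off-line {i} {j} _ (1≤j , j≤h) pi≡qj with euclidsLemma q j prime-p (divides i (trans (sym pi≡qj) (*-comm p i)))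
  ... | inj₁ p∣q = prime∤prime prime-p prime-q p≢q p∣q
  ... | inj₂ p∣j = P.∤-< 1≤j (P.≤h⇒<p j≤h) p∣j

-- The Jacobi symbol

odd⇒≡2h+1 : ∀ {n} → 2 ∤ n → n ≡ suc (n / 2 + n / 2)
odd⇒≡2h+1 {n} 2∤n = trans (m≡m%n+[m/n]*n n 2) (cong₂ _+_ n%2≡1 (h*2≡h+h (n / 2)))
  where
  h*2≡h+h : ∀ h → h * 2 ≡ h + h
  h*2≡h+h = solve-∀
  n%2≡1 : n % 2 ≡ 1
  n%2≡1 with n % 2 | m%n<n n 2 | m%n≡0⇒n∣m n 2
  ... | zero | _ | n%2≡0⇒2∣n = ⊥-elim (2∤n (n%2≡0⇒2∣n refl))
  ... | suc zero | _ | _ = refl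
  ... | suc (suc _) | s≤s (s≤s ()) | _

[2h+1]/2≡h : ∀ h → suc (h + h) / 2 ≡ h
[2h+1]/2≡h h = trans (cong (λ u → suc u / 2) (h+h≡h*2 h))
  (trans (+-distrib-/-∣ʳ 1 {h * 2} {2} (divides h refl)) (m*n/n≡m h 2))
  where
  h+h≡h*2 : ∀ h → h + h ≡ h * 2
  h+h≡h*2 = solve-∀

∤-*-2 : ∀ {a b} → 2 ∤ a → 2 ∤ b → 2 ∤ a * b
∤-*-2 = PrimeModulus.∤-* prime[2]

-1^-*-half-* : ∀ x {a b} → 2 ∤ a → 2 ∤ b → -1^ (x * ((a * b) / 2)) ≡ -1^ (x * (a / 2)) ℤ.* -1^ (x * (b / 2))
-1^-*-half-* x {a} {b} 2∤a 2∤b = begin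
  -1^ (x * ((a * b) / 2))                        ≡⟨ cong (λ n → -1^ (x * n)) (trans (cong (_/ 2) ab≡) ([2h+1]/2≡h _)) ⟩
  -1^ (x * (u + v + (u * v + u * v)))           ≡⟨ cong -1^_ (distribute x u v) ⟩
  -1^ (x * u + x * v + (x * u * v + x * u * v)) ≡⟨ -1^-+ (x * u + x * v) _ ⟩
  -1^ (x * u + x * v) ℤ.* -1^ (x * u * v + x * u * v)
                                                ≡⟨ cong (-1^ (x * u + x * v) ℤ.*_) (-1^-even (x * u * v)) ⟩
  -1^ (x * u + x * v) ℤ.* 1ℤ                    ≡⟨ ℤₚ.*-identityʳ _ ⟩
  -1^ (x * u + x * v)                           ≡⟨ -1^-+ (x * u) (x * v) ⟩
  -1^ (x * u) ℤ.* -1^ (x * v)                   ∎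
  where
  open ≡-Reasoning
  u = a / 2
  v = b / 2
  expand : ∀ u v → suc (u + u) * suc (v + v) ≡ suc ((u + v + (u * v + u * v)) + (u + v + (u * v + u * v)))
  expand = solve-∀
  ab≡ : a * b ≡ suc ((u + v + (u * v + u * v)) + (u + v + (u * v + u * v)))
  ab≡ = trans (cong₂ _*_ (odd⇒≡2h+1 2∤a) (odd⇒≡2h+1 2∤b)) (expand u v)
  distribute : ∀ x u v → x * (u + v + (u * v + u * v)) ≡ x * u + x * v + (x * u * v + x * u * v)
  distribute = solve-∀

IsOddPrime : ℕ → Set
IsOddPrime p = Prime p × 2 ∤ p

module OddPrime′ {p : ℕ} (odd-prime : IsOddPrime p) =
  OddPrime {h = p / 2} (proj₁ odd-prime) (odd⇒≡2h+1 (proj₂ odd-prime))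

legendreProduct : ℕ → List ℕ → ℤ
legendreProduct m ps = prodℤ (map (legendre m) ps)

2∤product : ∀ {ps} → All IsOddPrime ps → 2 ∤ product ps
2∤product [] 2∣1 = <⇒≢ (s≤s (s≤s z≤n)) (sym (∣1⇒≡1 2∣1))
2∤product ((_ , 2∤p) ∷ odd) = ∤-*-2 2∤p (2∤product odd)

legendreProduct-* : ∀ a b {ps} → All IsOddPrime ps →
  legendreProduct (a * b) ps ≡ legendreProduct a ps ℤ.* legendreProduct b ps
legendreProduct-* a b [] = refl
legendreProduct-* a b {p ∷ ps} (odd-p ∷ odd) =
  trans (cong₂ ℤ._*_ (OddPrime′.legendre-* odd-p a b) (legendreProduct-* a b odd))
        (interchange (legendre a p) (legendre b p) (legendreProduct a ps) (legendreProduct b ps))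
  where
  interchange : ∀ w x y z → (w ℤ.* x) ℤ.* (y ℤ.* z) ≡ (w ℤ.* y) ℤ.* (x ℤ.* z)
  interchange = ℤ-Solver.solve-∀

legendre-1 : ∀ {p} → Prime p → legendre 1 p ≡ 1ℤ
legendre-1 {p} p-prime
  with legendre-∤ p {{prime⇒nonZero p-prime}} {1} (λ p∣1 → <⇒≢ (prime⇒1< p-prime) (sym (∣1⇒≡1 p∣1)))
... | inj₁ (1↦1 , _) = 1↦1
... | inj₂ (_ , ¬□1) = ⊥-elim (¬□1 (1 , refl))

legendreProduct-1 : ∀ {ps} → All Prime ps → legendreProduct 1 ps ≡ 1ℤ
legendreProduct-1 [] = refl
legendreProduct-1 (p-prime ∷ primes) = cong₂ ℤ._*_ (legendre-1 p-prime) (legendreProduct-1 primes)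

legendreProduct-cong : ∀ {a b n ps} .{{_ : NonZero n}} → All Prime ps → All (_∣ n) ps →
  a % n ≡ b % n → legendreProduct a ps ≡ legendreProduct b ps
legendreProduct-cong [] [] _ = refl
legendreProduct-cong {a} {b} {n} {p ∷ _} (p-prime ∷ primes) (p∣n ∷ ∣n) a≈b =
  cong₂ ℤ._*_ (legendre-cong p (trans (sym (m∣n⇒o%n%m≡o%m p n a p∣n))
                               (trans (cong (_% p) a≈b) (m∣n⇒o%n%m≡o%m p n b p∣n))))
              (legendreProduct-cong primes ∣n a≈b)
  where instance _ = prime⇒nonZero p-prime

legendreProduct-[-1] : ∀ {c ps} → All IsOddPrime ps → All (_∣ suc c) ps → legendreProduct c ps ≡ -1^ (product ps / 2)
legendreProduct-[-1] [] [] = refl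
legendreProduct-[-1] {c} {p ∷ ps} (odd-p ∷ odd) (p∣c+1 ∷ ∣c+1) = begin
  legendre c p ℤ.* legendreProduct c ps
    ≡⟨ cong₂ ℤ._*_ (trans (legendre-cong p (∣suc⇒≈p∸1 p∣c+1)) legendre-[p∸1]) (legendreProduct-[-1] odd ∣c+1) ⟩
  -1^ (p / 2) ℤ.* -1^ (product ps / 2)
    ≡⟨ cong₂ ℤ._*_ (cong -1^_ (*-identityˡ (p / 2))) (cong -1^_ (*-identityˡ (product ps / 2))) ⟨
  -1^ (1 * (p / 2)) ℤ.* -1^ (1 * (product ps / 2))
    ≡⟨ -1^-*-half-* 1 (proj₂ odd-p) (2∤product odd) ⟨
  -1^ (1 * ((p * product ps) / 2))
    ≡⟨ cong -1^_ (*-identityˡ ((p * product ps) / 2)) ⟩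
  -1^ ((p * product ps) / 2) ∎
  where
  open ≡-Reasoning
  open OddPrime′ {p} odd-p

legendreProduct-reciprocityˡ : ∀ {p qs} → IsOddPrime p → All IsOddPrime qs → All (p ≢_) qs →
  legendreProduct p qs ℤ.* legendre (product qs) p ≡ -1^ ((p / 2) * (product qs / 2))
legendreProduct-reciprocityˡ {p} odd-p [] [] = begin
  1ℤ ℤ.* legendre 1 p  ≡⟨ ℤₚ.*-identityˡ _ ⟩
  legendre 1 p         ≡⟨ legendre-1 (proj₁ odd-p) ⟩
  1ℤ                   ≡⟨ cong -1^_ (*-zeroʳ (p / 2)) ⟨
  -1^ ((p / 2) * 0)    ∎
  where open ≡-Reasoning
legendreProduct-reciprocityˡ {p} {q ∷ qs} odd-p (odd-q ∷ odd) (p≢q ∷ p≢) = begin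
  legendre p q ℤ.* legendreProduct p qs ℤ.* legendre (q * Q) p
    ≡⟨ cong (legendre p q ℤ.* legendreProduct p qs ℤ.*_) (legendre-* q Q) ⟩
  legendre p q ℤ.* legendreProduct p qs ℤ.* (legendre q p ℤ.* legendre Q p)
    ≡⟨ interchange (legendre p q) (legendreProduct p qs) (legendre q p) (legendre Q p) ⟩
  (legendre q p ℤ.* legendre p q) ℤ.* (legendreProduct p qs ℤ.* legendre Q p)
    ≡⟨ cong₂ ℤ._*_ (quadratic-reciprocity {h = p / 2} {q / 2} (proj₁ odd-p) (proj₁ odd-q) p≢q
                                        (odd⇒≡2h+1 (proj₂ odd-p)) (odd⇒≡2h+1 (proj₂ odd-q)))
                   (legendreProduct-reciprocityˡ odd-p odd p≢) ⟩
  -1^ ((p / 2) * (q / 2)) ℤ.* -1^ ((p / 2) * (Q / 2))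
    ≡⟨ -1^-*-half-* (p / 2) (proj₂ odd-q) (2∤product odd) ⟨
  -1^ ((p / 2) * ((q * Q) / 2)) ∎
  where
  open ≡-Reasoning
  open OddPrime′ {p} odd-p
  Q = product qs
  interchange : ∀ w x y z → w ℤ.* x ℤ.* (y ℤ.* z) ≡ y ℤ.* w ℤ.* (x ℤ.* z)
  interchange = ℤ-Solver.solve-∀

legendreProduct-reciprocity : ∀ {ps qs} → All IsOddPrime ps → All IsOddPrime qs → All (λ p → All (p ≢_) qs) ps →
  legendreProduct (product ps) qs ℤ.* legendreProduct (product qs) ps ≡ -1^ ((product ps / 2) * (product qs / 2))
legendreProduct-reciprocity [] odd-qs [] = trans (ℤₚ.*-identityʳ _) (legendreProduct-1 (All.map proj₁ odd-qs))
legendreProduct-reciprocity {p ∷ ps} {qs} (odd-p ∷ odd-ps) odd-qs (p≢ ∷ disjoint) = begin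
  legendreProduct (p * P) qs ℤ.* (legendre Q p ℤ.* legendreProduct Q ps)
    ≡⟨ cong (ℤ._* (legendre Q p ℤ.* legendreProduct Q ps)) (legendreProduct-* p P odd-qs) ⟩
  legendreProduct p qs ℤ.* legendreProduct P qs ℤ.* (legendre Q p ℤ.* legendreProduct Q ps)
    ≡⟨ interchange (legendreProduct p qs) (legendreProduct P qs) (legendre Q p) (legendreProduct Q ps) ⟩
  (legendreProduct p qs ℤ.* legendre Q p) ℤ.* (legendreProduct P qs ℤ.* legendreProduct Q ps)
    ≡⟨ cong₂ ℤ._*_ (legendreProduct-reciprocityˡ odd-p odd-qs p≢) (legendreProduct-reciprocity odd-ps odd-qs disjoint) ⟩
  -1^ ((p / 2) * (Q / 2)) ℤ.* -1^ ((P / 2) * (Q / 2))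
    ≡⟨ cong₂ (λ u v → -1^ u ℤ.* -1^ v) (*-comm (p / 2) (Q / 2)) (*-comm (P / 2) (Q / 2)) ⟩
  -1^ ((Q / 2) * (p / 2)) ℤ.* -1^ ((Q / 2) * (P / 2))
    ≡⟨ -1^-*-half-* (Q / 2) (proj₂ odd-p) (2∤product odd-ps) ⟨
  -1^ ((Q / 2) * ((p * P) / 2))
    ≡⟨ cong -1^_ (*-comm (Q / 2) _) ⟩
  -1^ (((p * P) / 2) * (Q / 2)) ∎
  where
  open ≡-Reasoning
  P = product ps
  Q = product qs
  interchange : ∀ w x y z → w ℤ.* x ℤ.* (y ℤ.* z) ≡ w ℤ.* y ℤ.* (x ℤ.* z)
  interchange = ℤ-Solver.solve-∀

primeFactors : (n : ℕ) .{{_ : NonZero n}} → List ℕ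
primeFactors n = factors (factorise n)

module _ (n : ℕ) .{{_ : NonZero n}} where

  product-primeFactors : n ≡ product (primeFactors n)
  product-primeFactors = PrimeFactorisation.isFactorisation (factorise n)

  primeFactors-prime : All Prime (primeFactors n)
  primeFactors-prime = PrimeFactorisation.factorsPrime (factorise n)

  primeFactors-∣ : All (_∣ n) (primeFactors n)
  primeFactors-∣ = All.tabulate λ p∈ → subst (_ ∣_) (sym product-primeFactors) (∈⇒∣product p∈)

  primeFactors-odd : 2 ∤ n → All IsOddPrime (primeFactors n)
  primeFactors-odd 2∤n = All.zipWith (λ (p-prime , p∣n) → p-prime , λ 2∣p → 2∤n (∣-trans 2∣p p∣n))
                                     (primeFactors-prime , primeFactors-∣)

jacobiSymbol : ℕ → (n : ℕ) .{{_ : NonZero n}} → ℤ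
jacobiSymbol m n = legendreProduct m (primeFactors n)

jacobi-odd : ∀ m n .{{_ : NonZero n}} → 2 ∤ n → jacobi m n ≡ val (jacobiSymbol m n)
jacobi-odd m (suc k) 2∤n with 2 ∣? suc k
... | yes 2∣n = ⊥-elim (2∤n 2∣n)
... | no _ = refl

module _ {n : ℕ} .{{_ : NonZero n}} (2∤n : 2 ∤ n) where

  jacobiSymbol-* : ∀ a b → jacobiSymbol (a * b) n ≡ jacobiSymbol a n ℤ.* jacobiSymbol b n
  jacobiSymbol-* a b = legendreProduct-* a b (primeFactors-odd n 2∤n)

  jacobiSymbol-cong : ∀ {a b} → a % n ≡ b % n → jacobiSymbol a n ≡ jacobiSymbol b n
  jacobiSymbol-cong = legendreProduct-cong (primeFactors-prime n) (primeFactors-∣ n)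

  jacobiSymbol-1 : jacobiSymbol 1 n ≡ 1ℤ
  jacobiSymbol-1 = legendreProduct-1 (primeFactors-prime n)

  jacobiSymbol-[-1] : ∀ {c} → n ∣ suc c → jacobiSymbol c n ≡ -1^ (n / 2)
  jacobiSymbol-[-1] n∣c+1 = trans
    (legendreProduct-[-1] (primeFactors-odd n 2∤n) (All.map (λ p∣n → ∣-trans p∣n n∣c+1) (primeFactors-∣ n)))
    (cong (λ u → -1^ (u / 2)) (sym (product-primeFactors n)))

jacobi-reciprocity : ∀ {m n} .{{_ : NonZero m}} .{{_ : NonZero n}} → 2 ∤ m → 2 ∤ n → Coprime m n →
  jacobiSymbol m n ℤ.* jacobiSymbol n m ≡ -1^ ((m / 2) * (n / 2))
jacobi-reciprocity {m} {n} 2∤m 2∤n coprime = begin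
  jacobiSymbol m n ℤ.* jacobiSymbol n m
    ≡⟨ cong₂ (λ u v → legendreProduct u (primeFactors n) ℤ.* legendreProduct v (primeFactors m))
             (product-primeFactors m) (product-primeFactors n) ⟩
  legendreProduct (product (primeFactors m)) (primeFactors n)
    ℤ.* legendreProduct (product (primeFactors n)) (primeFactors m)
    ≡⟨ legendreProduct-reciprocity (primeFactors-odd m 2∤m) (primeFactors-odd n 2∤n) disjoint ⟩
  -1^ ((product (primeFactors m) / 2) * (product (primeFactors n) / 2))
    ≡⟨ cong₂ (λ u v → -1^ ((u / 2) * (v / 2))) (product-primeFactors m) (product-primeFactors n) ⟨
  -1^ ((m / 2) * (n / 2)) ∎
  where
  open ≡-Reasoning
  disjoint : All (λ p → All (p ≢_) (primeFactors n)) (primeFactors m)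
  disjoint = All.zipWith
    (λ (p-prime , p∣m) → All.map (λ { q∣n refl → <⇒≢ (prime⇒1< p-prime) (sym (coprime (p∣m , q∣n))) }) (primeFactors-∣ n))
    (primeFactors-prime m , primeFactors-∣ m)

-- Denominators of convergents

even-or-odd : ∀ k → ∃ λ i → k ≡ i + i ⊎ k ≡ suc (i + i)
even-or-odd zero = 0 , inj₁ refl
even-or-odd (suc k) with even-or-odd k
... | i , inj₁ k≡2i = i , inj₂ (cong suc k≡2i)
... | i , inj₂ k≡2i+1 = suc i , inj₁ (cong suc (trans k≡2i+1 (sym (+-suc i i))))

-- The two signs of the determinant identity s (k + 1) t k − s k t (k + 1) = (−1)ᵏ, kept in ℕ.
Det⁺ Det⁻ : (ℕ → ℕ) → ℕ → Set
Det⁺ b k = s b (suc k) * t b k ≡ s b k * t b (suc k) + 1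
Det⁻ b k = s b k * t b (suc k) ≡ s b (suc k) * t b k + 1

module _ (b : ℕ → ℕ) where

  private
    Det⁺-0 : Det⁺ b 0
    Det⁺-0 = identity (b 1) (b 0)
      where
      identity : ∀ x y → (x * y + 1) * 1 ≡ y * x + 1
      identity = solve-∀

    Det⁺⇒Det⁻ : ∀ k → Det⁺ b k → Det⁻ b (suc k)
    Det⁺⇒Det⁻ k det = begin
      s b (suc k) * (β * t b (suc k) + t b k)          ≡⟨ expand β (s b (suc k)) (t b (suc k)) (t b k) ⟩
      β * (s b (suc k) * t b (suc k)) + s b (suc k) * t b k
                                                      ≡⟨ cong (β * (s b (suc k) * t b (suc k)) +_) det ⟩
      β * (s b (suc k) * t b (suc k)) + (s b k * t b (suc k) + 1)
                                                      ≡⟨ collect β (s b (suc k)) (t b (suc k)) (s b k) ⟩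
      (β * s b (suc k) + s b k) * t b (suc k) + 1     ∎
      where
      open ≡-Reasoning
      β = b (suc (suc k))
      expand : ∀ β x y z → x * (β * y + z) ≡ β * (x * y) + x * z
      expand = solve-∀
      collect : ∀ β x y w → β * (x * y) + (w * y + 1) ≡ (β * x + w) * y + 1
      collect = solve-∀

    Det⁻⇒Det⁺ : ∀ k → Det⁻ b k → Det⁺ b (suc k)
    Det⁻⇒Det⁺ k det = begin
      (β * s b (suc k) + s b k) * t b (suc k)          ≡⟨ expand β (s b (suc k)) (t b (suc k)) (s b k) ⟩
      β * (s b (suc k) * t b (suc k)) + s b k * t b (suc k)
                                                      ≡⟨ cong (β * (s b (suc k) * t b (suc k)) +_) det ⟩
      β * (s b (suc k) * t b (suc k)) + (s b (suc k) * t b k + 1)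
                                                      ≡⟨ collect β (s b (suc k)) (t b (suc k)) (t b k) ⟩
      s b (suc k) * (β * t b (suc k) + t b k) + 1     ∎
      where
      open ≡-Reasoning
      β = b (suc (suc k))
      expand : ∀ β x y w → (β * x + w) * y ≡ β * (x * y) + w * y
      expand = solve-∀
      collect : ∀ β x y z → β * (x * y) + (x * z + 1) ≡ x * (β * y + z) + 1
      collect = solve-∀

  determinant : ∀ i → Det⁺ b (i + i) × Det⁻ b (suc (i + i))
  determinant zero = Det⁺-0 , Det⁺⇒Det⁻ 0 Det⁺-0
  determinant (suc i) = det⁺ , Det⁺⇒Det⁻ (suc i + suc i) det⁺
    where
    det⁺ : Det⁺ b (suc i + suc i)
    det⁺ = subst (Det⁺ b) (sym (cong suc (+-suc i i))) (Det⁻⇒Det⁺ (suc (i + i)) (proj₂ (determinant i)))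

  determinant-either : ∀ k → Det⁺ b k ⊎ Det⁻ b k
  determinant-either k with even-or-odd k
  ... | i , inj₁ k≡2i = inj₁ (subst (Det⁺ b) (sym k≡2i) (proj₁ (determinant i)))
  ... | i , inj₂ k≡2i+1 = inj₂ (subst (Det⁻ b) (sym k≡2i+1) (proj₂ (determinant i)))

  coprime-t : ∀ k → Coprime (t b k) (t b (suc k))
  coprime-t k {d} (d∣tₖ , d∣tₖ₊₁) = ∣1⇒≡1 (d∣1 (determinant-either k))
    where
    d∣1 : Det⁺ b k ⊎ Det⁻ b k → d ∣ 1
    d∣1 (inj₁ det) = ∣m+n∣m⇒∣n (subst (d ∣_) det (∣n⇒∣m*n (s b (suc k)) d∣tₖ)) (∣n⇒∣m*n (s b k) d∣tₖ₊₁)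
    d∣1 (inj₂ det) = ∣m+n∣m⇒∣n (subst (d ∣_) det (∣n⇒∣m*n (s b k) d∣tₖ₊₁)) (∣n⇒∣m*n (s b (suc k)) d∣tₖ)

-- A periodic Jacobi sequence

/2-of-1mod4 : ∀ x → x % 4 ≡ 1 → x / 2 ≡ x / 4 + x / 4
/2-of-1mod4 x x%4≡1 = trans (cong (_/ 2) x≡) ([2h+1]/2≡h (x / 4 + x / 4))
  where
  expand : ∀ q → 1 + q * 4 ≡ suc ((q + q) + (q + q))
  expand = solve-∀
  x≡ : x ≡ suc ((x / 4 + x / 4) + (x / 4 + x / 4))
  x≡ = trans (m≡m%n+[m/n]*n x 4) (trans (cong (_+ x / 4 * 4) x%4≡1) (expand (x / 4)))

/2-of-3mod4 : ∀ x → x % 4 ≡ 3 → x / 2 ≡ suc (x / 4 + x / 4)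
/2-of-3mod4 x x%4≡3 = trans (cong (_/ 2) x≡) ([2h+1]/2≡h (suc (x / 4 + x / 4)))
  where
  expand : ∀ q → 3 + q * 4 ≡ suc (suc (q + q) + suc (q + q))
  expand = solve-∀
  x≡ : x ≡ suc (suc (x / 4 + x / 4) + suc (x / 4 + x / 4))
  x≡ = trans (m≡m%n+[m/n]*n x 4) (trans (cong (_+ x / 4 * 4) x%4≡3) (expand (x / 4)))

module OddDenominators (b : ℕ → ℕ) (t-odd : ∀ k → 2 ∤ t b k)
                       (t≡1mod4 : ∀ k → t b k % 4 ≡ 1 ⊎ t b (suc k) % 4 ≡ 1) where

  t≢0 : ∀ k → NonZero (t b k)
  t≢0 k = ≢-nonZero λ t≡0 → t-odd k (subst (2 ∣_) (sym t≡0) (2 ∣0))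

  private
    even-sign : ∀ w y → -1^ ((w + w) * y) ≡ 1ℤ
    even-sign w y = trans (cong -1^_ (*-distribʳ-+ y w w)) (-1^-even (w * y))

    reciprocity-sign : ∀ k → -1^ ((t b k / 2) * (t b (suc k) / 2)) ≡ 1ℤ
    reciprocity-sign k with t≡1mod4 k
    ... | inj₁ tₖ≡1 = trans (cong (λ u → -1^ (u * (t b (suc k) / 2))) (/2-of-1mod4 (t b k) tₖ≡1))
                            (even-sign (t b k / 4) (t b (suc k) / 2))
    ... | inj₂ tₖ₊₁≡1 = trans (cong -1^_ (trans (*-comm (t b k / 2) (t b (suc k) / 2))
                                              (cong (_* (t b k / 2)) (/2-of-1mod4 (t b (suc k)) tₖ₊₁≡1))))
                              (even-sign (t b (suc k) / 4) (t b k / 2))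

  jacobiSymbol-t : ∀ k → jacobiSymbol (t b k) (t b (suc k)) {{t≢0 (suc k)}} ≡ 1ℤ
  jacobiSymbol-t zero = jacobiSymbol-1 {{t≢0 1}} (t-odd 1)
  jacobiSymbol-t (suc k) = begin
    x               ≡⟨ ℤₚ.*-identityʳ x ⟨
    x ℤ.* 1ℤ        ≡⟨ cong (x ℤ.*_) y≡1 ⟨
    x ℤ.* y         ≡⟨ jacobi-reciprocity (t-odd (suc k)) (t-odd (suc (suc k))) (coprime-t b (suc k)) ⟩
    -1^ ((t b (suc k) / 2) * (t b (suc (suc k)) / 2)) ≡⟨ reciprocity-sign (suc k) ⟩
    1ℤ              ∎
    where
    open ≡-Reasoning
    instance
      _ = t≢0 (suc k)
      _ = t≢0 (suc (suc k))
    x = jacobiSymbol (t b (suc k)) (t b (suc (suc k)))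
    y = jacobiSymbol (t b (suc (suc k))) (t b (suc k))
    y≡1 : y ≡ 1ℤ
    y≡1 = trans (jacobiSymbol-cong (t-odd (suc k))
                   (trans (cong (_% t b (suc k)) (+-comm (b (suc (suc k)) * t b (suc k)) (t b k)))
                          ([m+kn]%n≡m%n (t b k) (b (suc (suc k))) (t b (suc k)))))
                (jacobiSymbol-t k)

  private
    jacobiSymbol-s : ∀ k → jacobiSymbol (s b (suc k)) (t b (suc k)) {{t≢0 (suc k)}}
                         ≡ jacobiSymbol (s b (suc k) * t b k) (t b (suc k)) {{t≢0 (suc k)}}
    jacobiSymbol-s k = begin
      𝕁 (s b (suc k))                     ≡⟨ ℤₚ.*-identityʳ _ ⟨
      𝕁 (s b (suc k)) ℤ.* 1ℤ              ≡⟨ cong (𝕁 (s b (suc k)) ℤ.*_) (jacobiSymbol-t k) ⟨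
      𝕁 (s b (suc k)) ℤ.* 𝕁 (t b k)       ≡⟨ jacobiSymbol-* {{t≢0 (suc k)}} (t-odd (suc k)) (s b (suc k)) (t b k) ⟨
      𝕁 (s b (suc k) * t b k)             ∎
      where
      open ≡-Reasoning
      𝕁 : ℕ → ℤ
      𝕁 m = jacobiSymbol m (t b (suc k)) {{t≢0 (suc k)}}

    jacobiSeq≡ : ∀ k → jacobiSeq b (suc k) ≡ val (jacobiSymbol (s b (suc k) * t b k) (t b (suc k)) {{t≢0 (suc k)}})
    jacobiSeq≡ k = trans (jacobi-odd _ _ {{t≢0 (suc k)}} (t-odd (suc k))) (cong val (jacobiSymbol-s k))

  jacobiSeq-odd : ∀ i → jacobiSeq b (suc (i + i)) ≡ val 1ℤ
  jacobiSeq-odd i = trans (jacobiSeq≡ k) (cong val (trans (jacobiSymbol-cong (t-odd m) st≈1) (jacobiSymbol-1 (t-odd m))))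
    where
    k = i + i
    m = suc k
    instance _ = t≢0 m
    st≈1 : (s b m * t b k) % t b m ≡ 1 % t b m
    st≈1 = trans (cong (_% t b m) (trans (proj₁ (determinant b i)) (+-comm (s b k * t b m) 1)))
                 ([m+kn]%n≡m%n 1 (s b k) (t b m))

  jacobiSeq-even : ∀ i → jacobiSeq b (suc (suc (i + i))) ≡ val (-1^ (t b (suc (suc (i + i))) / 2))
  jacobiSeq-even i = trans (jacobiSeq≡ k) (cong val (jacobiSymbol-[-1] (t-odd m) t∣st+1))
    where
    k = suc (i + i)
    m = suc k
    instance _ = t≢0 m
    t∣st+1 : t b m ∣ suc (s b m * t b k)
    t∣st+1 = divides (s b k) (trans (+-comm 1 _) (sym (proj₂ (determinant b i))))

∣distance∣ : ∀ {d x y} → d ∣ y → d ∣ ℤ.∣ x ℤ.⊖ y ∣ → d ∣ x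
∣distance∣ {d} {x} {y} d∣y d∣dist with ≤-total y x
... | inj₁ y≤x = ∣m∸n∣n⇒∣m d y≤x (subst (d ∣_) (trans (ℤₚ.∣m⊖n∣≡∣n⊖m∣ x y) (ℤₚ.∣⊖∣-≤ y≤x)) d∣dist)
                   d∣y
... | inj₂ x≤y = ∣m+n∣m⇒∣n (subst (d ∣_) (sym (m∸n+n≡m x≤y)) d∣y) (subst (d ∣_) (ℤₚ.∣⊖∣-≤ x≤y) d∣dist)

∣distance∣⁻ : ∀ {d x y} → d ∣ x → d ∣ y → d ∣ ℤ.∣ x ℤ.⊖ y ∣
∣distance∣⁻ {d} {x} {y} d∣x d∣y with ≤-total y x
... | inj₁ y≤x = subst (d ∣_) (sym (trans (ℤₚ.∣m⊖n∣≡∣n⊖m∣ x y) (ℤₚ.∣⊖∣-≤ y≤x)))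
                   (∣m+n∣m⇒∣n (subst (d ∣_) (sym (m+[n∸m]≡n y≤x)) d∣x) d∣y)
... | inj₂ x≤y = subst (d ∣_) (sym (ℤₚ.∣⊖∣-≤ x≤y)) (∣m+n∣m⇒∣n (subst (d ∣_) (sym (m+[n∸m]≡n x≤y)) d∣y) d∣x)

module PeriodicJacobi (L : ℕ) (2∣L : 2 ∣ L) (2≤L : 2 ≤ L) where

  -- The indices 2, 2 + L, 2 + 2L, … are exactly those whose denominator is 3 (mod 4).
  marked : ℕ → Bool
  marked zero = false
  marked (suc zero) = false
  marked (suc (suc i)) = does (L ∣? i)

  b : ℕ → ℕ
  b zero = 1
  b (suc zero) = 1
  b (suc (suc i)) = if marked (suc (suc i)) xor marked i then 2 else 4

  residue : Bool → ℕ
  residue false = 1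
  residue true = 3

  t-mod4 : ∀ k → t b k % 4 ≡ residue (marked k) × t b (suc k) % 4 ≡ residue (marked (suc k))
  t-mod4 zero = refl , refl
  t-mod4 (suc k) with tₖ , tₖ₊₁ ← t-mod4 k = tₖ₊₁ , (begin
    (b (suc (suc k)) * t b (suc k) + t b k) % 4
      ≡⟨ +-cong {β * t b (suc k)} {β * residue (marked (suc k))} {t b k} {residue (marked k)}
                (*-congˡ β {t b (suc k)} (trans tₖ₊₁ (residue<4 (marked (suc k))))) (trans tₖ (residue<4 (marked k))) ⟩
    (b (suc (suc k)) * residue (marked (suc k)) + residue (marked k)) % 4
      ≡⟨ step (marked (suc (suc k))) (marked k) (marked (suc k)) ⟩
    residue (marked (suc (suc k))) ∎)
    where
    open ≡-Reasoning
    open Modular 4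
    β = b (suc (suc k))
    residue<4 : ∀ x → residue x ≡ residue x % 4
    residue<4 false = refl
    residue<4 true = refl
    step : ∀ x y z → ((if x xor y then 2 else 4) * residue z + residue y) % 4 ≡ residue x
    step false false false = refl
    step false false true = refl
    step false true false = refl
    step false true true = refl
    step true false false = refl
    step true false true = refl
    step true true false = refl
    step true true true = refl

  t-odd : ∀ k → 2 ∤ t b k
  t-odd k 2∣t = residue-odd (marked k) (subst (2 ∣_) (proj₁ (t-mod4 k)) (%-presˡ-∣ 2∣t (divides 2 refl)))
    where
    residue-odd : ∀ x → 2 ∤ residue x
    residue-odd false 2∣1 with () ← ∣1⇒≡1 2∣1
    residue-odd true (divides (suc (suc q)) ())

  marked-consecutive : ∀ k → marked k ≡ false ⊎ marked (suc k) ≡ false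
  marked-consecutive zero = inj₁ refl
  marked-consecutive (suc zero) = inj₁ refl
  marked-consecutive (suc (suc i)) with L ∣? i | L ∣? suc i
  ... | no _ | _ = inj₁ refl
  ... | yes _ | no _ = inj₂ refl
  ... | yes L∣i | yes L∣i+1 = ⊥-elim (<⇒≢ 2≤L (sym (∣1⇒≡1 (∣m+n∣m⇒∣n (subst (L ∣_) (+-comm 1 i) L∣i+1) L∣i))))

  t≡1mod4 : ∀ k → t b k % 4 ≡ 1 ⊎ t b (suc k) % 4 ≡ 1
  t≡1mod4 k with marked-consecutive k
  ... | inj₁ unmarked = inj₁ (trans (proj₁ (t-mod4 k)) (cong residue unmarked))
  ... | inj₂ unmarked = inj₂ (trans (proj₂ (t-mod4 k)) (cong residue unmarked))

  sign : Bool → ℤ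
  sign false = 1ℤ
  sign true = -1ℤ

  private
    open OddDenominators b t-odd t≡1mod4

    marked-odd : ∀ i → marked (suc (i + i)) ≡ false
    marked-odd zero = refl
    marked-odd (suc j) with L ∣? (j + suc j)
    ... | no _ = refl
    ... | yes L∣2j+1 = ⊥-elim (<⇒≢ (s≤s (s≤s z≤n)) (sym (∣1⇒≡1 (∣m+n∣m⇒∣n 2∣1+2j (divides j (j+j≡j*2 j))))))
      where
      2∣1+2j : 2 ∣ j + j + 1
      2∣1+2j = subst (2 ∣_) (trans (+-suc j j) (+-comm 1 (j + j))) (∣-trans 2∣L L∣2j+1)
      j+j≡j*2 : ∀ j → j + j ≡ j * 2
      j+j≡j*2 = solve-∀

    sign-of-half : ∀ x c → x % 4 ≡ residue c → -1^ (x / 2) ≡ sign c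
    sign-of-half x false x%4≡1 = trans (cong -1^_ (/2-of-1mod4 x x%4≡1)) (-1^-even (x / 4))
    sign-of-half x true x%4≡3 = trans (cong -1^_ (/2-of-3mod4 x x%4≡3)) (cong (-1ℤ ℤ.*_) (-1^-even (x / 4)))

  jacobiSeq-marked : ∀ k → jacobiSeq b (suc k) ≡ val (sign (marked (suc k)))
  jacobiSeq-marked k with even-or-odd k
  ... | i , inj₁ refl = trans (jacobiSeq-odd i) (cong (val ∘ sign) (sym (marked-odd i)))
  ... | i , inj₂ refl = trans (jacobiSeq-even i) (cong val (sign-of-half (t b m) (marked m) (proj₁ (t-mod4 m))))
    where m = suc (suc (i + i))

  b-four : IsFourRep b
  b-four zero = s≤s z≤n , s≤s z≤n
  b-four (suc zero) = s≤s z≤n , s≤s z≤n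
  b-four (suc (suc i)) with marked (suc (suc i)) xor marked i
  ... | true = s≤s z≤n , s≤s (s≤s z≤n)
  ... | false = s≤s z≤n , ≤-refl

  private
    L∣?-periodic : ∀ i → does (L ∣? (L + i)) ≡ does (L ∣? i)
    L∣?-periodic i with L ∣? (L + i) | L ∣? i
    ... | yes _ | yes _ = refl
    ... | no _ | no _ = refl
    ... | yes L∣L+i | no L∤i = ⊥-elim (L∤i (∣m+n∣m⇒∣n L∣L+i ∣-refl))
    ... | no L∤L+i | yes L∣i = ⊥-elim (L∤L+i (∣m∣n⇒∣m+n ∣-refl L∣i))

    L+2+ : ∀ i → L + suc (suc i) ≡ suc (suc (L + i))
    L+2+ i = trans (+-suc L (suc i)) (cong suc (+-suc L i))

    marked-periodic : ∀ i → marked (L + suc (suc i)) ≡ marked (suc (suc i))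
    marked-periodic i = trans (cong marked (L+2+ i)) (L∣?-periodic i)

  b-periodic : EventuallyPeriodic b
  b-periodic = 4 , L , ≤-trans (s≤s z≤n) 2≤L , periodic
    where
    periodic : ∀ k → 4 ≤ k → b (L + k) ≡ b k
    periodic (suc (suc (suc (suc j)))) (s≤s (s≤s (s≤s (s≤s z≤n)))) = trans (cong b (L+2+ (suc (suc j))))
      (cong₂ (λ x y → if x xor y then 2 else 4) (L∣?-periodic (suc (suc j))) (marked-periodic j))

  private
    3+j≡[mod]⇔L∣1+j : ∀ j → ((3 + j) ≡ 3 + L ∸ 1 [mod L ]) ⇔ L ∣ suc j
    3+j≡[mod]⇔L∣1+j j = mk⇔ (λ L∣dist → ∣distance∣ ∣-refl (subst (L ∣_) dist≡ L∣dist))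
                           (λ L∣1+j → subst (L ∣_) (sym dist≡) (∣distance∣⁻ L∣1+j ∣-refl))
      where
      dist≡ : ℤ.∣ ℤ.+ (3 + j) ℤ.- ℤ.+ (2 + L) ∣ ≡ ℤ.∣ suc j ℤ.⊖ L ∣
      dist≡ = cong ℤ.∣_∣ (trans (ℤₚ.m-n≡m⊖n (3 + j) (2 + L))
                         (trans (ℤₚ.[1+m]⊖[1+n]≡m⊖n (2 + j) (suc L)) (ℤₚ.[1+m]⊖[1+n]≡m⊖n (suc j) L)))

  jacobiSeq-pattern : ∀ k → 3 ≤ k →
    (k ≡ 3 + L ∸ 1 [mod L ] → jacobiSeq b k ≡ val -1ℤ) × (¬ (k ≡ 3 + L ∸ 1 [mod L ]) → jacobiSeq b k ≡ val 1ℤ)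
  jacobiSeq-pattern (suc (suc (suc j))) (s≤s (s≤s (s≤s z≤n))) =
    (λ ≡[mod] → trans (jacobiSeq-marked (2 + j)) (cong (val ∘ sign) (dec-true (L ∣? suc j) (to ≡[mod]))))
    , (λ ≢[mod] → trans (jacobiSeq-marked (2 + j)) (cong (val ∘ sign) (dec-false (L ∣? suc j) (≢[mod] ∘ from))))
    where open Equivalence (3+j≡[mod]⇔L∣1+j j)

-- Aperiodic Jacobi sequences

isStar : JVal → Bool
isStar (val _) = false
isStar star = true

isStar-jacobi : ∀ m n → isStar (jacobi m n) ≡ does (2 ∣? n)
isStar-jacobi m zero = refl
isStar-jacobi m (suc k) with 2 ∣? suc k
... | yes 2∣n = sym (dec-true (2 ∣? suc k) 2∣n)
... | no 2∤n = sym (dec-false (2 ∣? suc k) 2∤n)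

spread : (ℕ → Bool) → ℕ → Bool
spread d zero = true
spread d (suc zero) = d 0
spread d (suc (suc k)) = spread (d ∘ suc) k

spread-odd : ∀ d i → spread d (suc (i + i)) ≡ d i
spread-odd d zero = refl
spread-odd d (suc i) = trans (cong (spread d ∘ suc ∘ suc) (+-suc i i)) (spread-odd (d ∘ suc) i)

spread-step : ∀ d k → spread d (suc k) ≡ true ⊎ spread d (suc (suc k)) ≡ spread d k
spread-step d zero = inj₂ refl
spread-step d (suc zero) = inj₁ refl
spread-step d (suc (suc k)) = spread-step (d ∘ suc) k

interleave : (ℕ → Bool) → (ℕ → Bool) → ℕ → Bool
interleave f g zero = f 0
interleave f g (suc zero) = g 0
interleave f g (suc (suc k)) = interleave (f ∘ suc) (g ∘ suc) k

interleave-even : ∀ f g i → interleave f g (i + i) ≡ f i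
interleave-even f g zero = refl
interleave-even f g (suc i) = trans (cong (interleave f g ∘ suc) (+-suc i i)) (interleave-even (f ∘ suc) (g ∘ suc) i)

interleave-odd : ∀ f g i → interleave f g (suc (i + i)) ≡ g i
interleave-odd f g zero = refl
interleave-odd f g (suc i) = trans (cong (interleave f g ∘ suc ∘ suc) (+-suc i i)) (interleave-odd (f ∘ suc) (g ∘ suc) i)

-- A 4-representative whose denominators tₖ are odd exactly where spread d is true.
module StarPattern (d : ℕ → Bool) where

  odd? : ℕ → Bool
  odd? = spread d

  b : ℕ → ℕ
  b zero = 1
  b (suc zero) = if odd? 1 then 1 else 2
  b (suc (suc k)) = if odd? (suc (suc k)) xor odd? k then 1 else 2

  bit : Bool → ℕ
  bit false = 0
  bit true = 1

  t-mod2 : ∀ k → t b k % 2 ≡ bit (odd? k) × t b (suc k) % 2 ≡ bit (odd? (suc k))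
  t-mod2 zero = refl , first (odd? 1)
    where
    first : ∀ x → (if x then 1 else 2) % 2 ≡ bit x
    first false = refl
    first true = refl
  t-mod2 (suc k) with tₖ , tₖ₊₁ ← t-mod2 k = tₖ₊₁ , (begin
    (β * t b (suc k) + t b k) % 2
      ≡⟨ +-cong {β * t b (suc k)} {β * bit (odd? (suc k))} {t b k} {bit (odd? k)}
                (*-congˡ β {t b (suc k)} (trans tₖ₊₁ (bit<2 (odd? (suc k))))) (trans tₖ (bit<2 (odd? k))) ⟩
    (β * bit (odd? (suc k)) + bit (odd? k)) % 2
      ≡⟨ step (odd? (suc (suc k))) (odd? k) (odd? (suc k)) (spread-step d k) ⟩
    bit (odd? (suc (suc k))) ∎)
    where
    open ≡-Reasoning
    open Modular 2
    β = b (suc (suc k))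
    bit<2 : ∀ x → bit x ≡ bit x % 2
    bit<2 false = refl
    bit<2 true = refl
    step : ∀ x y z → z ≡ true ⊎ x ≡ y → ((if x xor y then 1 else 2) * bit z + bit y) % 2 ≡ bit x
    step true true false _ = refl
    step true true true _ = refl
    step false false false _ = refl
    step false false true _ = refl
    step true false true _ = refl
    step false true true _ = refl
    step true false false (inj₂ ())
    step false true false (inj₂ ())

  b-four : IsFourRep b
  b-four zero = s≤s z≤n , s≤s z≤n
  b-four (suc zero) with odd? 1
  ... | true = s≤s z≤n , s≤s z≤n
  ... | false = s≤s z≤n , s≤s (s≤s z≤n)
  b-four (suc (suc k)) with odd? (suc (suc k)) xor odd? k
  ... | true = s≤s z≤n , s≤s z≤n
  ... | false = s≤s z≤n , s≤s (s≤s z≤n)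

  isStar-jacobiSeq : ∀ k → isStar (jacobiSeq b k) ≡ not (odd? k)
  isStar-jacobiSeq k = trans (isStar-jacobi (s b k) (t b k)) (even? (odd? k) (proj₁ (t-mod2 k)))
    where
    even? : ∀ x → t b k % 2 ≡ bit x → does (2 ∣? t b k) ≡ not x
    even? true t%2≡1 = dec-false (2 ∣? t b k) λ 2∣t → 0≢1+n (trans (sym (n∣m⇒m%n≡0 _ 2 2∣t)) t%2≡1)
    even? false t%2≡0 = dec-true (2 ∣? t b k) (m%n≡0⇒n∣m _ 2 t%2≡0)

square? : ℕ → Bool
square? n = does (any? (λ y → y * y ≟ n) (upTo (suc n)))

private
  m≤m*m : ∀ m → m ≤ m * m
  m≤m*m zero = z≤n
  m≤m*m (suc m) = m≤m*n (suc m) (suc m)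

square?-square : ∀ a → square? (a * a) ≡ true
square?-square a = dec-true (any? _ (upTo (suc (a * a)))) (lose (∈-upTo⁺ (s≤s (m≤m*m a))) refl)

square?-between : ∀ {a n} → a * a < n → n < suc a * suc a → square? n ≡ false
square?-between {a} {n} a²<n n<[a+1]² = dec-false (any? _ (upTo (suc n))) λ y²≡n∈ →
  let y , y²≡n = satisfied y²≡n∈ in case-split y y²≡n
  where
  case-split : ∀ y → y * y ≡ n → ⊥
  case-split y y²≡n with y ≤? a
  ... | yes y≤a = <⇒≱ a²<n (subst (_≤ a * a) y²≡n (*-mono-≤ y≤a y≤a))
  ... | no y≰a = <⇒≱ n<[a+1]² (subst (suc a * suc a ≤_) y²≡n (*-mono-≤ (≰⇒> y≰a) (≰⇒> y≰a)))

-- Consecutive squares near a² are more than P apart once a ≥ P.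
square?-aperiodic : ∀ N P → 0 < P → ¬ (∀ n → N ≤ n → square? (n + P) ≡ square? n)
square?-aperiodic N P 0<P periodic = true≢false (begin
  true                 ≡⟨ square?-square a ⟨
  square? (a * a)      ≡⟨ periodic (a * a) N≤a² ⟨
  square? (a * a + P)  ≡⟨ square?-between {a} a²<a²+P a²+P<[a+1]² ⟩
  false                ∎)
  where
  open ≡-Reasoning
  a = N + P
  true≢false : true ≢ false
  true≢false ()
  N≤a² : N ≤ a * a
  N≤a² = ≤-trans (m≤m+n N P) (m≤m*m a)
  a²<a²+P : a * a < a * a + P
  a²<a²+P = subst (_≤ a * a + P) (+-comm (a * a) 1) (+-monoʳ-≤ (a * a) 0<P)
  a²+P<[a+1]² : a * a + P < suc a * suc a
  a²+P<[a+1]² = s≤s (≤-trans (+-monoʳ-≤ (a * a) (m≤n+m P N)) (≤-trans (m≤n+m (a * a + a) a) (≤-reflexive (expand a))))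
    where
    expand : ∀ a → a + (a * a + a) ≡ a + a * suc a
    expand = solve-∀

-- Odd places 4n + 1 of the star pattern record the squares; places 4n + 3 disagree with the n-th
-- enumerated sequence.
jacobiSeq-diagonal : ∀ (e : ℕ → ℕ → JVal) →
  Σ (ℕ → ℕ) λ b → IsFourRep b × ¬ EventuallyPeriodic (jacobiSeq b) × (∀ n → ¬ (∀ k → e n k ≡ jacobiSeq b k))
jacobiSeq-diagonal e = b , b-four , aperiodic , diagonal
  where
  square-place diagonal-place : ℕ → ℕ
  square-place n = suc ((n + n) + (n + n))
  diagonal-place n = suc (suc (n + n) + suc (n + n))

  disagree : ℕ → Bool
  disagree n = isStar (e n (diagonal-place n))

  open StarPattern (interleave square? disagree)

  odd?-jacobiSeq : ∀ k → odd? k ≡ not (isStar (jacobiSeq b k))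
  odd?-jacobiSeq k = trans (sym (not-involutive (odd? k))) (cong not (sym (isStar-jacobiSeq k)))

  diagonal : ∀ n → ¬ (∀ k → e n k ≡ jacobiSeq b k)
  diagonal n e≡ = not-¬ refl (begin
    isStar (e n k)         ≡⟨ interleave-odd square? disagree n ⟨
    interleave square? disagree (suc (n + n)) ≡⟨ spread-odd (interleave square? disagree) (suc (n + n)) ⟨
    odd? k                 ≡⟨ odd?-jacobiSeq k ⟩
    not (isStar (jacobiSeq b k)) ≡⟨ cong (not ∘ isStar) (e≡ k) ⟨
    not (isStar (e n k))   ∎)
    where
    open ≡-Reasoning
    k = diagonal-place n

  aperiodic : ¬ EventuallyPeriodic (jacobiSeq b)
  aperiodic (N , P , 0<P , periodic) = square?-aperiodic N P 0<P λ n N≤n → begin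
    square? (n + P)                                ≡⟨ square?-place (n + P) ⟨
    odd? (square-place (n + P))                    ≡⟨ odd?-jacobiSeq (square-place (n + P)) ⟩
    not (isStar (jacobiSeq b (square-place (n + P)))) ≡⟨ cong (λ k → not (isStar (jacobiSeq b k))) (shift n) ⟩
    not (isStar (jacobiSeq b (4 * P + square-place n))) ≡⟨ cong (not ∘ isStar) (periodic-multiple 4 (N≤place n N≤n)) ⟩
    not (isStar (jacobiSeq b (square-place n)))    ≡⟨ odd?-jacobiSeq (square-place n) ⟨
    odd? (square-place n)                          ≡⟨ square?-place n ⟩
    square? n                                      ∎
    where
    open ≡-Reasoning
    square?-place : ∀ n → odd? (square-place n) ≡ square? n
    square?-place n = trans (spread-odd (interleave square? disagree) (n + n)) (interleave-even square? disagree n)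
    shift : ∀ n → square-place (n + P) ≡ 4 * P + square-place n
    shift n = expand n P
      where
      expand : ∀ n P → suc ((n + P + (n + P)) + (n + P + (n + P))) ≡ 4 * P + suc ((n + n) + (n + n))
      expand = solve-∀
    N≤place : ∀ n → N ≤ n → N ≤ square-place n
    N≤place n N≤n = ≤-trans N≤n (≤-trans (m≤m+n n n) (≤-trans (m≤m+n (n + n) (n + n)) (n≤1+n _)))
    periodic-multiple : ∀ c {k} → N ≤ k → jacobiSeq b (c * P + k) ≡ jacobiSeq b k
    periodic-multiple zero N≤k = refl
    periodic-multiple (suc c) {k} N≤k = trans (cong (jacobiSeq b) (+-assoc P (c * P) k))
      (trans (periodic (c * P + k) (≤-trans N≤k (m≤n+m k (c * P)))) (periodic-multiple c N≤k))

jacobiSeq-periodic-pattern : ∀ (L : ℕ) → 2 ∣ L → 2 ≤ L →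
  Σ (ℕ → ℕ) λ b → IsFourRep b × EventuallyPeriodic b ×
    ∃ λ N → ∀ k → N ≤ k →
      (k ≡ N + L ∸ 1 [mod L ] → jacobiSeq b k ≡ val -1ℤ) × (¬ (k ≡ N + L ∸ 1 [mod L ]) → jacobiSeq b k ≡ val 1ℤ)
jacobiSeq-periodic-pattern L 2∣L 2≤L = b , b-four , b-periodic , 3 , jacobiSeq-pattern
  where open PeriodicJacobi L 2∣L 2≤L

-- Imported last: with +_ in scope, sections such as (m +_) above would be ambiguous.
open import Data.Integer using (+_; -[1+_])

theorem7 :
    (∀ (L : ℕ) → 2 ∣ L → 2 ≤ L →
      Σ (ℕ → ℕ) λ b → IsFourRep b × EventuallyPeriodic b ×
        ∃ λ N → ∀ k → N ≤ k →
          (k ≡ N + L ∸ 1 [mod L ] → jacobiSeq b k ≡ val -[1+ 0 ]) ×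
          (¬ (k ≡ N + L ∸ 1 [mod L ]) → jacobiSeq b k ≡ val (+ 1)))
    ×
    (∀ (e : ℕ → ℕ → JVal) →
      Σ (ℕ → ℕ) λ b → IsFourRep b × ¬ EventuallyPeriodic (jacobiSeq b) ×
        (∀ n → ¬ (∀ k → e n k ≡ jacobiSeq b k)))
theorem7 = jacobiSeq-periodic-pattern , jacobiSeq-diagonal
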